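{- Let $\mathcal{M}$ be a simple binary matroid on $[n]$, let $\mathbb{K}$ be a field, and let $\ell\ge4$ be a natural number. Then $\mathcal{M}$ is $\ell$-chordal if and only if the Orlik–Solomon algebra $\operatorname{OS}(\mathcal{M})$ is $(\ell-2)$-adic. In particular, $\mathcal{M}$ is chordal if and only if $\operatorname{OS}(\mathcal{M})$ is quadratic.
   Context: A matroid is binary if it is representable over $\mathbb{Z}_2$. $\mathcal{E}=\bigwedge\big(\bigoplus_{i=1}^n\mathbb{K}e_i\big)$; $e_X=e_{i_1}\wedge\dots\wedge e_{i_m}$ for $X=\{i_1<\dots<i_m\}$; $\partial$ is the degree $-1$ derivation with $\partial(e_i)=1$ and $\partial(a\wedge b)=\partial(a)\wedge b+(-1)^{\deg a}a\wedge\partial(b)$. For $\mathfrak{X}\subseteq2^{[n]}$, $\Im(\mathfrak{X})$ is the two-sided ideal generated by $\{\partial(e_X):X\in\mathfrak{X}\}$. $\mathfrak{C}$ is the set of circuits and $\mathfrak{C}_k$ the set of circuits with at most $k$ elements. $\operatorname{OS}(\mathcal{M})=\mathcal{E}/\Im(\mathfrak{C})$ is $m$-adic if $\Im(\mathfrak{C})=\Im(\mathfrak{C}_{m+1})$, and quadratic if it is $2$-adic. A circuit $C$ has a chord $i_\alpha$ if there are circuits $C_1,C_2$ with $C_1\cap C_2=\{i_\alpha\}$ and $C=C_1\Delta C_2$. $\mathcal{M}$ is $\ell$-chordal if every circuit with at least $\ell$ elements has a chord, and chordal if it is $4$-chordal. -}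

module Defs where

open import Level using (Level; _⊔_) renaming (suc to lsuc)
open import Data.Nat using (ℕ; zero; suc; _≤_)
import Data.Nat as ℕ
open import Data.Bool using (Bool; true; false; if_then_else_; not; _∧_; _xor_)
import Data.Bool as Bool
open import Data.Fin using (Fin)
open import Data.Fin.Subset using (Subset; inside; outside; ⊥; ⁅_⁆; _∈_; _∉_; _⊆_; _⊂_; _∩_; _∪_; _-_; _─_; ∣_∣; Nonempty)
open import Data.Vec using (Vec; []; _∷_; lookup; replicate; zipWith)
open import Data.Vec.Properties using (≡-dec)
open import Data.List using (List; []; _∷_; _++_; map; foldr; allFin)
open import Data.Product using (Σ; ∃; ∃-syntax; _×_; _,_)
open import Relation.Nullary using (¬_)
open import Relation.Nullary.Decidable using (⌊_⌋)
open import Relation.Binary.PropositionalEquality using (_≡_; _≢_)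
open import Algebra.Bundles using (CommutativeRing)

record Field (c ℓ : Level) : Set (lsuc (c ⊔ ℓ)) where
  field
    commutativeRing : CommutativeRing c ℓ
  open CommutativeRing commutativeRing public
  field
    nontrivial : ¬ (1# ≈ 0#)
    inverse    : ∀ x → ¬ (x ≈ 0#) → ∃[ y ] (x * y ≈ 1#)

record Matroid (n : ℕ) : Set₁ where
  field
    Circuit     : Subset n → Set
    empty-not   : ¬ Circuit ⊥
    incomparable : ∀ {C₁ C₂} → Circuit C₁ → Circuit C₂ → C₁ ⊆ C₂ → C₁ ≡ C₂
    elimination : ∀ {C₁ C₂ e} → Circuit C₁ → Circuit C₂ → C₁ ≢ C₂ →
                  e ∈ C₁ → e ∈ C₂ →
                  ∃[ C₃ ] (Circuit C₃ × C₃ ⊆ ((C₁ ∪ C₂) - e))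

open Matroid public

-- Simple: no loops and no parallel elements, i.e. no circuit of size ≤ 2.
Simple : ∀ {n} → Matroid n → Set
Simple M = ∀ C → Circuit M C → 3 ≤ ∣ C ∣

-- Binary representability: a matrix over ℤ₂ = (Bool, xor) with n columns
-- (column i is A i ∈ ℤ₂^r) whose minimal linearly dependent column sets
-- are exactly the circuits.  Over ℤ₂ a nontrivial linear combination is
-- a nonempty subset of columns, so dependence = some nonempty subset of
-- the columns sums to zero.

columnSum : ∀ {n r} → (Fin n → Vec Bool r) → Subset n → Vec Bool r
columnSum {n} {r} A T =
  foldr (λ i acc → if lookup T i then zipWith _xor_ (A i) acc else acc)
        (replicate r false) (allFin n)

Dependent : ∀ {n r} → (Fin n → Vec Bool r) → Subset n → Set
Dependent {r = r} A X =
  ∃[ T ] (Nonempty T × T ⊆ X × columnSum A T ≡ replicate r false)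

MinimalDependent : ∀ {n r} → (Fin n → Vec Bool r) → Subset n → Set
MinimalDependent A X = Dependent A X × (∀ Y → Y ⊂ X → ¬ Dependent A Y)

Binary : ∀ {n} → Matroid n → Set
Binary {n} M = ∃[ r ] ∃[ A ] (∀ X →
  (Circuit M X → MinimalDependent {n} {r} A X) ×
  (MinimalDependent A X → Circuit M X))

_Δ_ : ∀ {n} → Subset n → Subset n → Subset n
X Δ Y = zipWith _xor_ X Y

HasChord : ∀ {n} → Matroid n → Subset n → Set
HasChord M C = ∃[ i ] ∃[ C₁ ] ∃[ C₂ ]
  (Circuit M C₁ × Circuit M C₂ × (C₁ ∩ C₂) ≡ ⁅ i ⁆ × C ≡ (C₁ Δ C₂))

Chordal-ℓ : ∀ {n} → Matroid n → ℕ → Set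
Chordal-ℓ M l = ∀ C → Circuit M C → l ≤ ∣ C ∣ → HasChord M C

Chordal : ∀ {n} → Matroid n → Set
Chordal M = Chordal-ℓ M 4

Circuits≤ : ∀ {n} → Matroid n → ℕ → Subset n → Set
Circuits≤ M k C = Circuit M C × ∣ C ∣ ≤ k

allSubsets : (n : ℕ) → List (Subset n)
allSubsets zero    = [] ∷ []
allSubsets (suc n) = map (inside ∷_) (allSubsets n) ++ map (outside ∷_) (allSubsets n)

_≟S_ : ∀ {n} → (X Y : Subset n) → Bool
X ≟S Y = ⌊ ≡-dec Bool._≟_ X Y ⌋

-- inv X Y = #{ (x , y) : x ∈ X , y ∈ Y , y < x }
inv : ∀ {n} → Subset n → Subset n → ℕ
inv []      []      = 0
inv (b ∷ X) (c ∷ Y) = (if c then ∣ X ∣ else 0) ℕ.+ inv X Y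

-- The exterior algebra ℰ = ⋀(⊕ᵢ 𝕂 eᵢ) over a commutative ring, with
-- basis e_X (X ⊆ [n], e_X = e_{i₁} ∧ … ∧ e_{iₘ} for i₁ < … < iₘ).
-- An element is its coefficient function on the basis.

module Exterior {c ℓ} (R : CommutativeRing c ℓ) (n : ℕ) where
  open CommutativeRing R

  ℰ : Set c
  ℰ = Subset n → Carrier

  infix 4 _≈ℰ_
  _≈ℰ_ : ℰ → ℰ → Set ℓ
  a ≈ℰ b = ∀ X → a X ≈ b X

  0ℰ : ℰ
  0ℰ _ = 0#

  _+ℰ_ : ℰ → ℰ → ℰ
  (a +ℰ b) X = a X + b X

  sgn : ℕ → Carrier → Carrier
  sgn zero    x = x
  sgn (suc k) x = - sgn k x

  Σ[_]_ : ∀ {A : Set} → List A → (A → Carrier) → Carrier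
  Σ[ xs ] f = foldr (λ x acc → f x + acc) 0# xs

  e : Subset n → ℰ
  e X Y = if X ≟S Y then 1# else 0#

  -- wedge product: e_X ∧ e_Y = (-1)^{inv X Y} e_{X ∪ Y} if X ∩ Y = ∅, else 0
  _∧ℰ_ : ℰ → ℰ → ℰ
  (a ∧ℰ b) Z = Σ[ allSubsets n ] λ X →
    if (X ∩ Z) ≟S X then sgn (inv X (Z ─ X)) (a X * b (Z ─ X)) else 0#

  -- ∂ : the degree −1 derivation with ∂ eᵢ = 1, written out on the basis:
  -- ∂(e_X) = Σ_k (-1)^{k-1} e_{X ∖ i_k}; coefficient-wise,
  -- (∂ a)(Y) = Σ_{i ∉ Y} (-1)^{#{y ∈ Y : y < i}} a(Y ∪ {i}).
  ∂ : ℰ → ℰ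
  ∂ a Y = Σ[ allFin n ] λ i →
    if lookup Y i then 0# else sgn (inv ⁅ i ⁆ Y) (a (Y ∪ ⁅ i ⁆))

  data InIdeal (𝔛 : Subset n → Set) : ℰ → Set (c ⊔ ℓ) where
    gen  : ∀ {X} → 𝔛 X → InIdeal 𝔛 (∂ (e X))
    zer  : InIdeal 𝔛 0ℰ
    add  : ∀ {a b} → InIdeal 𝔛 a → InIdeal 𝔛 b → InIdeal 𝔛 (a +ℰ b)
    mulˡ : ∀ {a} (b : ℰ) → InIdeal 𝔛 a → InIdeal 𝔛 (b ∧ℰ a)
    mulʳ : ∀ {a} (b : ℰ) → InIdeal 𝔛 a → InIdeal 𝔛 (a ∧ℰ b)
    resp : ∀ {a b} → a ≈ℰ b → InIdeal 𝔛 a → InIdeal 𝔛 b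

  SameIdeal : (Subset n → Set) → (Subset n → Set) → Set (c ⊔ ℓ)
  SameIdeal 𝔛 𝔜 = ∀ a → (InIdeal 𝔛 a → InIdeal 𝔜 a) × (InIdeal 𝔜 a → InIdeal 𝔛 a)

-- OS(M) = ℰ / Im(𝔠) is m-adic iff Im(𝔠) = Im(𝔠_{m+1})
Adic : ∀ {c ℓ n} → Field c ℓ → Matroid n → ℕ → Set (c ⊔ ℓ)
Adic {n = n} K M m = SameIdeal (Circuit M) (Circuits≤ M (suc m))
  where open Exterior (Field.commutativeRing K) n

Quadratic : ∀ {c ℓ n} → Field c ℓ → Matroid n → Set (c ⊔ ℓ)
Quadratic K M = Adic K M 2

{-# OPTIONS --safe #-}

-- Let C = C₁ Δ C₂ with C₁ ∩ C₂ = {i} and put A = C₁ - i, B = C₂ - i.  Since ∂ is a derivation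
-- with ∂eᵢ = 1, the Leibniz rule gives (the two terms ∂e_A ∧ eᵢ ∧ ∂e_B cancel)
--   ∂(e_A ∧ e_B) = ∂(e_A ∧ eᵢ) ∧ ∂e_B + ∂e_A ∧ ∂(eᵢ ∧ e_B),
-- so ∂e_C lies in the ideal generated by ∂e_{C₁} and ∂e_{C₂}.  In a simple matroid C₁ and C₂
-- are smaller than C, so in an ℓ-chordal matroid induction on |C| puts every ∂e_C in the
-- ideal generated by the circuits with fewer than ℓ elements.
-- Conversely, let |C| ≥ ℓ.  Every element of the ideal generated by the circuits D with
-- |D| < ℓ vanishes on all subsets of C unless C has a chord: ∂e_D can be nonzero on Y ⊆ C
-- only if D = Y ∪ {j}, and in a binary matroid D together with a circuit through j inside
-- C Δ D is then a chord of C.  Since ∂e_C does not vanish on C - c, the OS algebra can only be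
-- (ℓ-2)-adic if C has a chord.

module Submission where

open import Defs
open import Level using (_⊔_)
open import Data.Nat using (ℕ; zero; suc; _≤_; _<_; _∸_; z≤n; s≤s; _≤?_) renaming (_+_ to _+ℕ_)
open import Data.Nat.Properties using (≤-trans; <⇒≱; <-irrefl; ≰⇒>)
open import Data.Nat.Induction using (<-wellFounded)
open import Data.Bool using (Bool; true; false; if_then_else_; _∨_; _xor_)
import Data.Bool as Bool
open import Data.Bool.Properties using (∨-zeroʳ; xor-assoc; xor-comm; xor-same; xor-identityˡ)
open import Data.Fin using (Fin; zero; suc)
import Data.Fin.Properties as Fin
open import Data.Fin.Subset
  using (Subset; inside; outside; ⊥; ⁅_⁆; _∩_; _∪_; _─_; _-_; ∣_∣; _⊆_; _⊂_; _∈_; _∉_; Nonempty)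
open import Data.Fin.Subset.Properties
  using ( ∪-identityˡ; ∪-identityʳ; ∪-comm; ∪-assoc; ∩-comm; ∩-zeroˡ; ∩-zeroʳ; ∩-abs-∪; p─⊥≡p; p─q⊆p; p∩q⊆q
        ; ∣⊥∣≡0; ∣⁅x⁆∣≡1; p⊆q⇒∣p∣≤∣q∣; p⊂q⇒∣p∣<∣q∣; ⊆-refl; ⊆-trans; ⊆-antisym; ⊆-⊂-trans; p⊂q⇒p⊆q
        ; _∈?_; _⊂?_; nonempty?; anySubset?; Empty-unique
        ; x∈p∧x≢y⇒x∈p-y; x∈⁅x⁆; x∈⁅y⁆⇒x≡y; x∈p∩q⁺; x∈p∩q⁻ )
open import Data.List using (List; []; _∷_; _++_; map; foldr; tabulate; allFin)
open import Data.Vec using (Vec; []; _∷_; lookup; replicate; zipWith)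
open import Data.Vec.Properties
  using ( ∷-injectiveˡ; ∷-injectiveʳ; lookup-replicate; lookup-zipWith; []=⇒lookup; lookup⇒[]=
        ; zipWith-assoc; zipWith-comm; zipWith-identityˡ; ≡-dec )
open import Data.Product using (_×_; _,_; proj₁; proj₂; ∃-syntax)
open import Data.Sum using (_⊎_; inj₁; inj₂)
import Data.Sum as Sum
open import Function using (_∘_; case_of_)
open import Function.Bundles using (_⇔_; mk⇔)
open import Relation.Nullary using (¬_; Dec; yes; no; contradiction; _×-dec_)
open import Relation.Nullary.Decidable using (isYes≗does; dec-true; dec-false)
open import Relation.Binary.Bundles using (Setoid)
import Relation.Binary.Construct.On as On
import Relation.Binary.Reasoning.Setoid as SetoidReasoning
import Relation.Binary.PropositionalEquality as ≡
open ≡ using (_≡_; _≢_; refl; sym; trans; cong; cong₂; subst; module ≡-Reasoning)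
open import Induction.WellFounded using (module All)
open import Algebra.Bundles using (CommutativeRing; CommutativeSemigroup)

module SubsetProperties where

  open import Data.Nat using (_+_; _*_)
  open import Data.Nat.Properties
    using (+-suc; +-assoc; *-suc; *-identityʳ; +-monoʳ-<; +-cancelʳ-<; >⇒≢; module ≤-Reasoning)
  open import Data.Nat.Solver using (module +-*-Solver)
  open +-*-Solver using (solve; _:=_; _:+_)

  private variable
    m : ℕ

  -- Names ending in ᵇ state membership through lookup, which is how ∂ and e inspect subsets.

  Disjoint : Subset m → Subset m → Set
  Disjoint X Y = X ∩ Y ≡ ⊥

  disjoint-comm : (p q : Subset m) → Disjoint p q → Disjoint q p
  disjoint-comm p q d = trans (∩-comm q p) d

  disjoint-─ : (p q : Subset m) → Disjoint p (q ─ p)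
  disjoint-─ []            []      = refl
  disjoint-─ (inside  ∷ p) (_ ∷ q) = cong (outside ∷_) (disjoint-─ p q)
  disjoint-─ (outside ∷ p) (_ ∷ q) = cong (outside ∷_) (disjoint-─ p q)

  disjoint-─ˡ : (p q r : Subset m) → Disjoint p q → Disjoint (p ─ r) q
  disjoint-─ˡ []      []            []            _ = refl
  disjoint-─ˡ (_ ∷ p) (_ ∷ q)       (inside  ∷ r) d =
    cong (outside ∷_) (disjoint-─ˡ p q r (∷-injectiveʳ d))
  disjoint-─ˡ (_ ∷ p) (_ ∷ q)       (outside ∷ r) d =
    cong₂ _∷_ (∷-injectiveˡ d) (disjoint-─ˡ p q r (∷-injectiveʳ d))

  disjoint-─ʳ : (p q r : Subset m) → Disjoint p q → Disjoint p (q ─ r)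
  disjoint-─ʳ p q r d = disjoint-comm (q ─ r) p (disjoint-─ˡ q p r (disjoint-comm p q d))

  disjoint-reassocʳ : (X Y W : Subset m) →
                      Disjoint X Y × Disjoint (X ∪ Y) W → Disjoint Y W × Disjoint X (Y ∪ W)
  disjoint-reassocʳ []            []            []            _ = refl , refl
  disjoint-reassocʳ (inside  ∷ X) (outside ∷ Y) (outside ∷ W) (d₁ , d₂)
    with disjoint-reassocʳ X Y W (∷-injectiveʳ d₁ , ∷-injectiveʳ d₂)
  ... | e₁ , e₂ = cong (outside ∷_) e₁ , cong (outside ∷_) e₂
  disjoint-reassocʳ (outside ∷ X) (_       ∷ Y) (_       ∷ W) (d₁ , d₂)
    with disjoint-reassocʳ X Y W (∷-injectiveʳ d₁ , ∷-injectiveʳ d₂)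
  ... | e₁ , e₂ = cong₂ _∷_ (∷-injectiveˡ d₂) e₁ , cong (outside ∷_) e₂
  disjoint-reassocʳ (inside  ∷ X) (inside  ∷ Y) (_       ∷ W) (() , _)
  disjoint-reassocʳ (inside  ∷ X) (outside ∷ Y) (inside  ∷ W) (_ , ())

  disjoint-reassocˡ : (X Y W : Subset m) →
                      Disjoint Y W × Disjoint X (Y ∪ W) → Disjoint X Y × Disjoint (X ∪ Y) W
  disjoint-reassocˡ []      []            []            _ = refl , refl
  disjoint-reassocˡ (inside  ∷ X) (outside ∷ Y) (outside ∷ W) (d₁ , d₂)
    with disjoint-reassocˡ X Y W (∷-injectiveʳ d₁ , ∷-injectiveʳ d₂)
  ... | e₁ , e₂ = cong (outside ∷_) e₁ , cong (outside ∷_) e₂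
  disjoint-reassocˡ (outside ∷ X) (outside ∷ Y) (outside ∷ W) (d₁ , d₂)
    with disjoint-reassocˡ X Y W (∷-injectiveʳ d₁ , ∷-injectiveʳ d₂)
  ... | e₁ , e₂ = cong (outside ∷_) e₁ , cong (outside ∷_) e₂
  disjoint-reassocˡ (outside ∷ X) (inside  ∷ Y) (outside ∷ W) (d₁ , d₂)
    with disjoint-reassocˡ X Y W (∷-injectiveʳ d₁ , ∷-injectiveʳ d₂)
  ... | e₁ , e₂ = cong (outside ∷_) e₁ , cong (outside ∷_) e₂
  disjoint-reassocˡ (outside ∷ X) (outside ∷ Y) (inside  ∷ W) (d₁ , d₂)
    with disjoint-reassocˡ X Y W (∷-injectiveʳ d₁ , ∷-injectiveʳ d₂)
  ... | e₁ , e₂ = cong (outside ∷_) e₁ , cong (outside ∷_) e₂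
  disjoint-reassocˡ (_       ∷ X) (inside  ∷ Y) (inside  ∷ W) (() , _)
  disjoint-reassocˡ (inside  ∷ X) (inside  ∷ Y) (outside ∷ W) (_ , ())
  disjoint-reassocˡ (inside  ∷ X) (outside ∷ Y) (inside  ∷ W) (_ , ())

  x∈⁅x⁆ᵇ : (x : Fin m) → lookup ⁅ x ⁆ x ≡ true
  x∈⁅x⁆ᵇ zero    = refl
  x∈⁅x⁆ᵇ (suc x) = x∈⁅x⁆ᵇ x

  y∉⁅x⁆ᵇ : {x y : Fin m} → y ≢ x → lookup ⁅ x ⁆ y ≡ false
  y∉⁅x⁆ᵇ {x = zero}  {zero}  y≢x = contradiction refl y≢x
  y∉⁅x⁆ᵇ {x = zero}  {suc y} _   = lookup-replicate y outside
  y∉⁅x⁆ᵇ {x = suc x} {zero}  _   = refl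
  y∉⁅x⁆ᵇ {x = suc x} {suc y} y≢x = y∉⁅x⁆ᵇ (y≢x ∘ cong suc)

  x∉p-xᵇ : (p : Subset m) (x : Fin m) → lookup (p - x) x ≡ false
  x∉p-xᵇ (_ ∷ p) zero    = refl
  x∉p-xᵇ (_ ∷ p) (suc x) = x∉p-xᵇ p x

  x∈p-yᵇ : (p : Subset m) {x y : Fin m} → lookup p x ≡ true → x ≢ y → lookup (p - y) x ≡ true
  x∈p-yᵇ (_ ∷ p) {zero}  {zero}  _  x≢y = contradiction refl x≢y
  x∈p-yᵇ (_ ∷ p) {zero}  {suc y} px _   = px
  x∈p-yᵇ (_ ∷ p) {suc x} {zero}  px _   = trans (cong (λ r → lookup r x) (p─⊥≡p p)) px
  x∈p-yᵇ (_ ∷ p) {suc x} {suc y} px x≢y = x∈p-yᵇ p px (x≢y ∘ cong suc)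

  x∈p∪⁅x⁆ᵇ : (p : Subset m) (x : Fin m) → lookup (p ∪ ⁅ x ⁆) x ≡ true
  x∈p∪⁅x⁆ᵇ (inside  ∷ p) zero    = refl
  x∈p∪⁅x⁆ᵇ (outside ∷ p) zero    = refl
  x∈p∪⁅x⁆ᵇ (_       ∷ p) (suc x) = x∈p∪⁅x⁆ᵇ p x

  x∈p⇒x∈p∪qᵇ : (p q : Subset m) (x : Fin m) → lookup p x ≡ true → lookup (p ∪ q) x ≡ true
  x∈p⇒x∈p∪qᵇ p q x px = trans (lookup-zipWith _∨_ x p q) (cong (_∨ lookup q x) px)

  x∈q⇒x∈p∪qᵇ : (p q : Subset m) (x : Fin m) → lookup q x ≡ true → lookup (p ∪ q) x ≡ true
  x∈q⇒x∈p∪qᵇ p q x qx =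
    trans (lookup-zipWith _∨_ x p q) (trans (cong (lookup p x ∨_) qx) (∨-zeroʳ (lookup p x)))

  x∉p∪qᵇ : (p q : Subset m) (x : Fin m) →
           lookup p x ≡ false → lookup q x ≡ false → lookup (p ∪ q) x ≡ false
  x∉p∪qᵇ p q x px qx = trans (lookup-zipWith _∨_ x p q) (cong₂ _∨_ px qx)

  x∈p∩q⇒x∈pᵇ : (p q : Subset m) (x : Fin m) → lookup (p ∩ q) x ≡ true → lookup p x ≡ true
  x∈p∩q⇒x∈pᵇ (inside ∷ p) (_ ∷ q) zero    _ = refl
  x∈p∩q⇒x∈pᵇ (_      ∷ p) (_ ∷ q) (suc x) h = x∈p∩q⇒x∈pᵇ p q x h

  disjoint-∉ᵇ : (p q : Subset m) (x : Fin m) → Disjoint p q → lookup p x ≡ true → lookup q x ≡ false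
  disjoint-∉ᵇ (inside ∷ p) (outside ∷ q) zero    _ _ = refl
  disjoint-∉ᵇ (inside ∷ p) (inside  ∷ q) zero    () _
  disjoint-∉ᵇ (_      ∷ p) (_       ∷ q) (suc x) d h = disjoint-∉ᵇ p q x (∷-injectiveʳ d) h

  ≢-at : ∀ {X Y : Subset m} j → lookup X j ≡ false → lookup Y j ≡ true → X ≢ Y
  ≢-at j Xj Yj refl with trans (sym Xj) Yj
  ... | ()

  ≟S-refl : (X : Subset m) → (X ≟S X) ≡ true
  ≟S-refl X = trans (isYes≗does (≡-dec Bool._≟_ X X)) (dec-true (≡-dec Bool._≟_ X X) refl)

  ≟S-≢ : {X Y : Subset m} → X ≢ Y → (X ≟S Y) ≡ false
  ≟S-≢ {X = X} {Y} X≢Y = trans (isYes≗does (≡-dec Bool._≟_ X Y)) (dec-false (≡-dec Bool._≟_ X Y) X≢Y)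

  disjoint-⁅x⁆ : (p : Subset m) (x : Fin m) → lookup p x ≡ false → Disjoint p ⁅ x ⁆
  disjoint-⁅x⁆ (outside ∷ p) zero    _ = cong (outside ∷_) (∩-zeroʳ p)
  disjoint-⁅x⁆ (inside  ∷ p) (suc x) h = cong (outside ∷_) (disjoint-⁅x⁆ p x h)
  disjoint-⁅x⁆ (outside ∷ p) (suc x) h = cong (outside ∷_) (disjoint-⁅x⁆ p x h)

  disjoint-p-x-⁅x⁆ : (p : Subset m) (x : Fin m) → Disjoint (p - x) ⁅ x ⁆
  disjoint-p-x-⁅x⁆ p x = disjoint-comm ⁅ x ⁆ (p - x) (disjoint-─ ⁅ x ⁆ p)

  p∪q─p≡q : (p q : Subset m) → Disjoint p q → p ∪ q ─ p ≡ q
  p∪q─p≡q []            []            _ = refl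
  p∪q─p≡q (inside  ∷ p) (outside ∷ q) d = cong (outside ∷_) (p∪q─p≡q p q (∷-injectiveʳ d))
  p∪q─p≡q (outside ∷ p) (q₀      ∷ q) d = cong (q₀ ∷_) (p∪q─p≡q p q (∷-injectiveʳ d))
  p∪q─p≡q (inside  ∷ p) (inside  ∷ q) ()

  p∪[q─p]≡q : (p q : Subset m) → p ∩ q ≡ p → p ∪ (q ─ p) ≡ q
  p∪[q─p]≡q []            []            _ = refl
  p∪[q─p]≡q (inside  ∷ p) (inside  ∷ q) s = cong (inside ∷_) (p∪[q─p]≡q p q (∷-injectiveʳ s))
  p∪[q─p]≡q (outside ∷ p) (q₀      ∷ q) s = cong (q₀ ∷_) (p∪[q─p]≡q p q (∷-injectiveʳ s))
  p∪[q─p]≡q (inside  ∷ p) (outside ∷ q) ()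

  ⁅x⁆-x≡⊥ : (x : Fin m) → ⁅ x ⁆ - x ≡ ⊥
  ⁅x⁆-x≡⊥ zero    = cong (outside ∷_) (p─⊥≡p ⊥)
  ⁅x⁆-x≡⊥ (suc x) = cong (outside ∷_) (⁅x⁆-x≡⊥ x)

  p∪⁅x⁆-x≡p : (p : Subset m) (x : Fin m) → lookup p x ≡ false → p ∪ ⁅ x ⁆ - x ≡ p
  p∪⁅x⁆-x≡p (outside ∷ p) zero    _ = cong (outside ∷_) (trans (p─⊥≡p (p ∪ ⊥)) (∪-identityʳ p))
  p∪⁅x⁆-x≡p (inside  ∷ p) (suc x) h = cong (inside ∷_) (p∪⁅x⁆-x≡p p x h)
  p∪⁅x⁆-x≡p (outside ∷ p) (suc x) h = cong (outside ∷_) (p∪⁅x⁆-x≡p p x h)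

  p-x∪⁅x⁆≡p : (p : Subset m) (x : Fin m) → lookup p x ≡ true → (p - x) ∪ ⁅ x ⁆ ≡ p
  p-x∪⁅x⁆≡p (inside  ∷ p) zero    _ = cong (inside ∷_) (trans (∪-identityʳ (p ─ ⊥)) (p─⊥≡p p))
  p-x∪⁅x⁆≡p (inside  ∷ p) (suc x) h = cong (inside ∷_) (p-x∪⁅x⁆≡p p x h)
  p-x∪⁅x⁆≡p (outside ∷ p) (suc x) h = cong (outside ∷_) (p-x∪⁅x⁆≡p p x h)

  p∪q-x≡[p-x]∪q : (p q : Subset m) (x : Fin m) → lookup q x ≡ false → p ∪ q - x ≡ (p - x) ∪ q
  p∪q-x≡[p-x]∪q (_ ∷ p) (outside ∷ q) zero    _ =
    cong (outside ∷_) (trans (p─⊥≡p (p ∪ q)) (cong (_∪ q) (sym (p─⊥≡p p))))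
  p∪q-x≡[p-x]∪q (_ ∷ p) (q₀ ∷ q)      (suc x) h = cong (_ ∷_) (p∪q-x≡[p-x]∪q p q x h)

  p∪q-x≡p∪[q-x] : (p q : Subset m) (x : Fin m) → lookup p x ≡ false → p ∪ q - x ≡ p ∪ (q - x)
  p∪q-x≡p∪[q-x] p q x h = begin
    p ∪ q - x    ≡⟨ cong (_- x) (∪-comm p q) ⟩
    q ∪ p - x    ≡⟨ p∪q-x≡[p-x]∪q q p x h ⟩
    (q - x) ∪ p  ≡⟨ ∪-comm (q - x) p ⟩
    p ∪ (q - x)  ∎
    where open ≡-Reasoning

  p─[p∩q]∪q─[p∩q]≡pΔq : (p q : Subset m) → (p ─ (p ∩ q)) ∪ (q ─ (p ∩ q)) ≡ p Δ q
  p─[p∩q]∪q─[p∩q]≡pΔq []            []            = refl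
  p─[p∩q]∪q─[p∩q]≡pΔq (inside  ∷ p) (inside  ∷ q) = cong (outside ∷_) (p─[p∩q]∪q─[p∩q]≡pΔq p q)
  p─[p∩q]∪q─[p∩q]≡pΔq (inside  ∷ p) (outside ∷ q) = cong (inside ∷_)  (p─[p∩q]∪q─[p∩q]≡pΔq p q)
  p─[p∩q]∪q─[p∩q]≡pΔq (outside ∷ p) (q₀      ∷ q) = cong (q₀ ∷_)      (p─[p∩q]∪q─[p∩q]≡pΔq p q)

  disjoint-p─[p∩q] : (p q : Subset m) → Disjoint (p ─ (p ∩ q)) (q ─ (p ∩ q))
  disjoint-p─[p∩q] []            []            = refl
  disjoint-p─[p∩q] (inside  ∷ p) (inside  ∷ q) = cong (outside ∷_) (disjoint-p─[p∩q] p q)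
  disjoint-p─[p∩q] (inside  ∷ p) (outside ∷ q) = cong (outside ∷_) (disjoint-p─[p∩q] p q)
  disjoint-p─[p∩q] (outside ∷ p) (_       ∷ q) = cong (outside ∷_) (disjoint-p─[p∩q] p q)

  module _ {p q : Subset m} {x : Fin m} (p∩q≡⁅x⁆ : p ∩ q ≡ ⁅ x ⁆) where

    ∩≡⁅x⁆⇒x∈pᵇ : lookup p x ≡ true
    ∩≡⁅x⁆⇒x∈pᵇ = x∈p∩q⇒x∈pᵇ p q x (trans (cong (λ r → lookup r x) p∩q≡⁅x⁆) (x∈⁅x⁆ᵇ x))

    ∩≡⁅x⁆⇒x∈qᵇ : lookup q x ≡ true
    ∩≡⁅x⁆⇒x∈qᵇ =
      x∈p∩q⇒x∈pᵇ q p x (trans (cong (λ r → lookup r x) (trans (∩-comm q p) p∩q≡⁅x⁆)) (x∈⁅x⁆ᵇ x))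

    ∩≡⁅x⁆⇒[p-x]∪[q-x]≡pΔq : (p - x) ∪ (q - x) ≡ p Δ q
    ∩≡⁅x⁆⇒[p-x]∪[q-x]≡pΔq =
      subst (λ r → (p ─ r) ∪ (q ─ r) ≡ p Δ q) p∩q≡⁅x⁆ (p─[p∩q]∪q─[p∩q]≡pΔq p q)

    ∩≡⁅x⁆⇒disjoint : Disjoint (p - x) (q - x)
    ∩≡⁅x⁆⇒disjoint = subst (λ r → Disjoint (p ─ r) (q ─ r)) p∩q≡⁅x⁆ (disjoint-p─[p∩q] p q)

  ⊆∧⊄⇒≡ : {p q : Subset m} → p ⊆ q → ¬ (p ⊂ q) → p ≡ q
  ⊆∧⊄⇒≡ {p = p} {q} p⊆q p⊄q = ⊆-antisym p⊆q q⊆p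
    where
    q⊆p : q ⊆ p
    q⊆p {x} x∈q with x ∈? p
    ... | yes x∈p = x∈p
    ... | no  x∉p = contradiction ((λ {y} → p⊆q {y}) , x , x∈q , x∉p) p⊄q

  x∈pΔq⁺ˡ : {p q : Subset m} {x : Fin m} → x ∈ p → x ∉ q → x ∈ p Δ q
  x∈pΔq⁺ˡ {p = p} {q} {x} x∈p x∉q with lookup q x in qx
  ... | true  = contradiction (lookup⇒[]= x q qx) x∉q
  ... | false = lookup⇒[]= x (p Δ q) (trans (lookup-zipWith _xor_ x p q) (cong₂ _xor_ ([]=⇒lookup x∈p) qx))

  x∈pΔq⁺ʳ : {p q : Subset m} {x : Fin m} → x ∉ p → x ∈ q → x ∈ p Δ q
  x∈pΔq⁺ʳ {p = p} {q} {x} x∉p x∈q with lookup p x in px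
  ... | true  = contradiction (lookup⇒[]= x p px) x∉p
  ... | false = lookup⇒[]= x (p Δ q) (trans (lookup-zipWith _xor_ x p q) (cong₂ _xor_ px ([]=⇒lookup x∈q)))

  x∈pΔq⁻ : {p q : Subset m} {x : Fin m} → x ∈ p Δ q → (x ∈ p × x ∉ q) ⊎ (x ∉ p × x ∈ q)
  x∈pΔq⁻ {p = p} {q} {x} x∈pΔq
    with lookup p x in px | lookup q x in qx | trans (sym (lookup-zipWith _xor_ x p q)) ([]=⇒lookup x∈pΔq)
  ... | true  | false | _ = inj₁ (lookup⇒[]= x p px , λ x∈q → case trans (sym ([]=⇒lookup x∈q)) qx of λ ())
  ... | false | true  | _ = inj₂ ((λ x∈p → case trans (sym ([]=⇒lookup x∈p)) px of λ ()) , lookup⇒[]= x q qx)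

  pΔq∩q⊆⁅y⁆ : {p q : Subset m} {x y : Fin m} → q - y ⊆ p → x ∈ p Δ q → x ∈ q → x ≡ y
  pΔq∩q⊆⁅y⁆ {x = x} {y} q-y⊆p x∈pΔq x∈q with x Fin.≟ y | x∈pΔq⁻ x∈pΔq
  ... | yes x≡y | _              = x≡y
  ... | no  x≢y | inj₁ (_ , x∉q) = contradiction x∈q x∉q
  ... | no  x≢y | inj₂ (x∉p , _) = contradiction (q-y⊆p (x∈p∧x≢y⇒x∈p-y x∈q x≢y)) x∉p

  ∣∪∣-disjoint : (X Y : Subset m) → Disjoint X Y → ∣ X ∪ Y ∣ ≡ ∣ X ∣ + ∣ Y ∣
  ∣∪∣-disjoint []            []            _ = refl
  ∣∪∣-disjoint (inside  ∷ X) (outside ∷ Y) d = cong suc (∣∪∣-disjoint X Y (∷-injectiveʳ d))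
  ∣∪∣-disjoint (outside ∷ X) (inside  ∷ Y) d =
    trans (cong suc (∣∪∣-disjoint X Y (∷-injectiveʳ d))) (sym (+-suc _ _))
  ∣∪∣-disjoint (outside ∷ X) (outside ∷ Y) d = ∣∪∣-disjoint X Y (∷-injectiveʳ d)
  ∣∪∣-disjoint (inside  ∷ X) (inside  ∷ Y) ()

  ∣p∣≡∣p-x∣+1 : (p : Subset m) (x : Fin m) → lookup p x ≡ true → ∣ p ∣ ≡ ∣ p - x ∣ + 1
  ∣p∣≡∣p-x∣+1 p x px = begin
    ∣ p ∣                  ≡⟨ cong ∣_∣ (sym (p-x∪⁅x⁆≡p p x px)) ⟩
    ∣ (p - x) ∪ ⁅ x ⁆ ∣    ≡⟨ ∣∪∣-disjoint (p - x) ⁅ x ⁆ (disjoint-p-x-⁅x⁆ p x) ⟩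
    ∣ p - x ∣ + ∣ ⁅ x ⁆ ∣  ≡⟨ cong (∣ p - x ∣ +_) (∣⁅x⁆∣≡1 x) ⟩
    ∣ p - x ∣ + 1          ∎
    where open ≡-Reasoning

  ∣p∣<∣pΔq∣ : {p q : Subset m} {x : Fin m} → p ∩ q ≡ ⁅ x ⁆ → 3 ≤ ∣ q ∣ → ∣ p ∣ < ∣ p Δ q ∣
  ∣p∣<∣pΔq∣ {p = p} {q} {x} p∩q≡⁅x⁆ 3≤∣q∣ = begin-strict
    ∣ p ∣                       ≡⟨ ∣p∣≡∣p-x∣+1 p x (∩≡⁅x⁆⇒x∈pᵇ p∩q≡⁅x⁆) ⟩
    ∣ p - x ∣ + 1               <⟨ +-monoʳ-< ∣ p - x ∣ 1<∣q-x∣ ⟩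
    ∣ p - x ∣ + ∣ q - x ∣       ≡⟨ ∣∪∣-disjoint (p - x) (q - x) (∩≡⁅x⁆⇒disjoint p∩q≡⁅x⁆) ⟨
    ∣ (p - x) ∪ (q - x) ∣       ≡⟨ cong ∣_∣ (∩≡⁅x⁆⇒[p-x]∪[q-x]≡pΔq p∩q≡⁅x⁆) ⟩
    ∣ p Δ q ∣                   ∎
    where
    open ≤-Reasoning
    1<∣q-x∣ : 1 < ∣ q - x ∣
    1<∣q-x∣ =
      +-cancelʳ-< 1 1 ∣ q - x ∣ (subst (2 <_) (∣p∣≡∣p-x∣+1 q x (∩≡⁅x⁆⇒x∈qᵇ p∩q≡⁅x⁆)) 3≤∣q∣)

  ∣q∣<∣pΔq∣ : {p q : Subset m} {x : Fin m} → p ∩ q ≡ ⁅ x ⁆ → 3 ≤ ∣ p ∣ → ∣ q ∣ < ∣ p Δ q ∣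
  ∣q∣<∣pΔq∣ {p = p} {q} p∩q≡⁅x⁆ 3≤∣p∣ =
    subst (∣ q ∣ <_) (cong ∣_∣ (zipWith-comm xor-comm q p))
          (∣p∣<∣pΔq∣ (trans (∩-comm q p) p∩q≡⁅x⁆) 3≤∣p∣)

  ∣p∣>0⇒nonempty : (p : Subset m) → 0 < ∣ p ∣ → Nonempty p
  ∣p∣>0⇒nonempty {m} p 0<∣p∣ with nonempty? p
  ... | yes p≠∅ = p≠∅
  ... | no  p≡∅ = contradiction (trans (cong ∣_∣ (Empty-unique p≡∅)) (∣⊥∣≡0 m)) (>⇒≢ 0<∣p∣)

  inv-⊥ʳ : (X : Subset m) → inv X ⊥ ≡ 0
  inv-⊥ʳ []      = refl
  inv-⊥ʳ (_ ∷ X) = inv-⊥ʳ X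

  inv-⊥ˡ : (X : Subset m) → inv ⊥ X ≡ 0
  inv-⊥ˡ []            = refl
  inv-⊥ˡ {suc m} (inside  ∷ X) = trans (cong (_+ inv ⊥ X) (∣⊥∣≡0 m)) (inv-⊥ˡ X)
  inv-⊥ˡ (outside ∷ X) = inv-⊥ˡ X

  inv-∪ʳ : (X Y W : Subset m) → Disjoint Y W → inv X (Y ∪ W) ≡ inv X Y + inv X W
  inv-∪ʳ []      []            []            _ = refl
  inv-∪ʳ (_ ∷ X) (inside  ∷ Y) (outside ∷ W) d
    rewrite inv-∪ʳ X Y W (∷-injectiveʳ d) = sym (+-assoc ∣ X ∣ (inv X Y) (inv X W))
  inv-∪ʳ (_ ∷ X) (outside ∷ Y) (inside  ∷ W) d
    rewrite inv-∪ʳ X Y W (∷-injectiveʳ d) =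
    solve 3 (λ x y w → x :+ (y :+ w) := y :+ (x :+ w)) refl ∣ X ∣ (inv X Y) (inv X W)
  inv-∪ʳ (_ ∷ X) (outside ∷ Y) (outside ∷ W) d = inv-∪ʳ X Y W (∷-injectiveʳ d)
  inv-∪ʳ (_ ∷ X) (inside  ∷ Y) (inside  ∷ W) ()

  inv-∪ˡ : (X W Y : Subset m) → Disjoint X W → inv (X ∪ W) Y ≡ inv X Y + inv W Y
  inv-∪ˡ []      []      []            _ = refl
  inv-∪ˡ (_ ∷ X) (_ ∷ W) (inside  ∷ Y) d
    rewrite ∣∪∣-disjoint X W (∷-injectiveʳ d) | inv-∪ˡ X W Y (∷-injectiveʳ d) =
    solve 4 (λ x w a b → (x :+ w) :+ (a :+ b) := (x :+ a) :+ (w :+ b)) refl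
      ∣ X ∣ ∣ W ∣ (inv X Y) (inv W Y)
  inv-∪ˡ (_ ∷ X) (_ ∷ W) (outside ∷ Y) d = inv-∪ˡ X W Y (∷-injectiveʳ d)

  inv-swap : (X Y : Subset m) → Disjoint X Y → inv X Y + inv Y X ≡ ∣ X ∣ * ∣ Y ∣
  inv-swap []            []            _ = refl
  inv-swap (inside  ∷ X) (outside ∷ Y) d =
    trans (solve 3 (λ a b y → a :+ (y :+ b) := y :+ (a :+ b)) refl (inv X Y) (inv Y X) ∣ Y ∣)
          (cong (∣ Y ∣ +_) (inv-swap X Y (∷-injectiveʳ d)))
  inv-swap (outside ∷ X) (inside  ∷ Y) d =
    trans (+-assoc ∣ X ∣ (inv X Y) (inv Y X))
          (trans (cong (∣ X ∣ +_) (inv-swap X Y (∷-injectiveʳ d))) (sym (*-suc ∣ X ∣ ∣ Y ∣)))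
  inv-swap (outside ∷ X) (outside ∷ Y) d = inv-swap X Y (∷-injectiveʳ d)
  inv-swap (inside  ∷ X) (inside  ∷ Y) ()

  inv-reassoc : (X Y W : Subset m) → Disjoint X Y → Disjoint Y W →
                inv X Y + inv (X ∪ Y) W ≡ inv Y W + inv X (Y ∪ W)
  inv-reassoc X Y W d₁ d₂
    rewrite inv-∪ˡ X Y W d₁ | inv-∪ʳ X Y W d₂ =
    solve 3 (λ xy xw yw → xy :+ (xw :+ yw) := yw :+ (xy :+ xw)) refl (inv X Y) (inv X W) (inv Y W)

  inv-removeˡ : (X Y : Subset m) (j : Fin m) → lookup X j ≡ true → inv X Y ≡ inv (X - j) Y + inv ⁅ j ⁆ Y
  inv-removeˡ X Y j Xj =
    trans (cong (λ T → inv T Y) (sym (p-x∪⁅x⁆≡p X j Xj)))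
          (inv-∪ˡ (X - j) ⁅ j ⁆ Y (disjoint-p-x-⁅x⁆ X j))

  inv-removeʳ : (X Y : Subset m) (j : Fin m) → lookup Y j ≡ true → inv X Y ≡ inv X (Y - j) + inv X ⁅ j ⁆
  inv-removeʳ X Y j Yj =
    trans (cong (inv X) (sym (p-x∪⁅x⁆≡p Y j Yj))) (inv-∪ʳ X (Y - j) ⁅ j ⁆ (disjoint-p-x-⁅x⁆ Y j))

  inv-leibnizˡ : (X Y : Subset m) (j : Fin m) → Disjoint X Y → lookup X j ≡ true →
                 inv X Y + inv ⁅ j ⁆ ((X - j) ∪ Y) ≡
                 (inv ⁅ j ⁆ (X - j) + inv (X - j) Y) + (inv ⁅ j ⁆ Y + inv ⁅ j ⁆ Y)
  inv-leibnizˡ X Y j d Xj = begin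
    inv X Y + inv ⁅ j ⁆ ((X - j) ∪ Y)
      ≡⟨ cong₂ _+_ (inv-removeˡ X Y j Xj) (inv-∪ʳ ⁅ j ⁆ (X - j) Y (disjoint-─ˡ X Y ⁅ j ⁆ d)) ⟩
    (inv (X - j) Y + inv ⁅ j ⁆ Y) + (inv ⁅ j ⁆ (X - j) + inv ⁅ j ⁆ Y)
      ≡⟨ solve 3 (λ a b t → (a :+ t) :+ (b :+ t) := (b :+ a) :+ (t :+ t)) refl
           (inv (X - j) Y) (inv ⁅ j ⁆ (X - j)) (inv ⁅ j ⁆ Y) ⟩
    (inv ⁅ j ⁆ (X - j) + inv (X - j) Y) + (inv ⁅ j ⁆ Y + inv ⁅ j ⁆ Y) ∎
    where open ≡-Reasoning

  inv-leibnizʳ : (X Y : Subset m) (j : Fin m) → Disjoint X Y → lookup X j ≡ false → lookup Y j ≡ true →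
                 inv X Y + inv ⁅ j ⁆ (X ∪ (Y - j)) ≡ ∣ X ∣ + (inv ⁅ j ⁆ (Y - j) + inv X (Y - j))
  inv-leibnizʳ X Y j d Xj Yj = begin
    inv X Y + inv ⁅ j ⁆ (X ∪ (Y - j))
      ≡⟨ cong₂ _+_ (inv-removeʳ X Y j Yj) (inv-∪ʳ ⁅ j ⁆ X (Y - j) (disjoint-─ʳ X Y ⁅ j ⁆ d)) ⟩
    (inv X (Y - j) + inv X ⁅ j ⁆) + (inv ⁅ j ⁆ X + inv ⁅ j ⁆ (Y - j))
      ≡⟨ solve 4 (λ a p q b → (a :+ p) :+ (q :+ b) := (p :+ q) :+ (b :+ a)) refl
           (inv X (Y - j)) (inv X ⁅ j ⁆) (inv ⁅ j ⁆ X) (inv ⁅ j ⁆ (Y - j)) ⟩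
    (inv X ⁅ j ⁆ + inv ⁅ j ⁆ X) + (inv ⁅ j ⁆ (Y - j) + inv X (Y - j))
      ≡⟨ cong (_+ (inv ⁅ j ⁆ (Y - j) + inv X (Y - j))) (inv-swap X ⁅ j ⁆ (disjoint-⁅x⁆ X j Xj)) ⟩
    ∣ X ∣ * ∣ ⁅ j ⁆ ∣ + (inv ⁅ j ⁆ (Y - j) + inv X (Y - j))
      ≡⟨ cong (λ k → ∣ X ∣ * k + (inv ⁅ j ⁆ (Y - j) + inv X (Y - j))) (∣⁅x⁆∣≡1 j) ⟩
    ∣ X ∣ * 1 + (inv ⁅ j ⁆ (Y - j) + inv X (Y - j))
      ≡⟨ cong (_+ (inv ⁅ j ⁆ (Y - j) + inv X (Y - j))) (*-identityʳ ∣ X ∣) ⟩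
    ∣ X ∣ + (inv ⁅ j ⁆ (Y - j) + inv X (Y - j)) ∎
    where open ≡-Reasoning


open SubsetProperties

module ExteriorProperties {c ℓ} (R : CommutativeRing c ℓ) (n : ℕ) where

  open CommutativeRing R
    renaming (refl to ≈-refl; sym to ≈-sym; trans to ≈-trans; reflexive to ≈-reflexive)
    hiding (_-_; zero)
  open import Algebra.Properties.Ring ring using (-‿distribˡ-*; -‿involutive; -1*x≈-x)
  open import Algebra.Properties.CommutativeSemigroup *-commutativeSemigroup
    using (x∙yz≈y∙xz)
  open import Algebra.Properties.CommutativeSemigroup +-commutativeSemigroup
    using () renaming (interchange to +-interchange)
  open Exterior R n
  module ≈-Reasoning = SetoidReasoning setoid
  open import Data.Nat.Properties using (+-suc)

  sgn-add : ∀ k l x → sgn (k +ℕ l) x ≡ sgn k (sgn l x)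
  sgn-add zero    l x = refl
  sgn-add (suc k) l x = cong -_ (sgn-add k l x)

  sign : ℕ → Carrier
  sign k = sgn k 1#

  sgn≈sign* : ∀ k x → sgn k x ≈ sign k * x
  sgn≈sign* zero    x = ≈-sym (*-identityˡ x)
  sgn≈sign* (suc k) x = ≈-trans (-‿cong (sgn≈sign* k x)) (-‿distribˡ-* (sign k) x)

  sgn-cong : ∀ k {x y} → x ≈ y → sgn k x ≈ sgn k y
  sgn-cong zero    x≈y = x≈y
  sgn-cong (suc k) x≈y = -‿cong (sgn-cong k x≈y)

  sgn-zero : ∀ k → sgn k 0# ≈ 0#
  sgn-zero k = ≈-trans (sgn≈sign* k 0#) (zeroʳ _)

  sgn-*ˡ : ∀ k x y → sgn k (x * y) ≈ x * sgn k y
  sgn-*ˡ k x y = begin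
    sgn k (x * y)     ≈⟨ sgn≈sign* k (x * y) ⟩
    sign k * (x * y)  ≈⟨ x∙yz≈y∙xz (sign k) x y ⟩
    x * (sign k * y)  ≈⟨ *-congˡ (sgn≈sign* k y) ⟨
    x * sgn k y       ∎
    where open ≈-Reasoning

  sgn-+ : ∀ k x y → sgn k (x + y) ≈ sgn k x + sgn k y
  sgn-+ k x y = ≈-trans (sgn≈sign* k (x + y))
    (≈-trans (distribˡ (sign k) x y) (≈-sym (+-cong (sgn≈sign* k x) (sgn≈sign* k y))))

  sign-+ : ∀ k l → sign (k +ℕ l) ≈ sign k * sign l
  sign-+ k l = ≈-trans (≈-reflexive (sgn-add k l 1#)) (sgn≈sign* k (sign l))

  sign-*-sign : ∀ k l x → sign k * (sign l * x) ≈ sign (k +ℕ l) * x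
  sign-*-sign k l x = ≈-trans (≈-sym (*-assoc _ _ _)) (*-congʳ (≈-sym (sign-+ k l)))

  *-assoc-cong : ∀ {a b c} x → a * b ≈ c → a * (b * x) ≈ c * x
  *-assoc-cong {a} {b} x ab≈c = ≈-trans (≈-sym (*-assoc a b x)) (*-congʳ ab≈c)

  sign-double : ∀ k → sign (k +ℕ k) ≈ 1#
  sign-double zero    = ≈-refl
  sign-double (suc k) = begin
    - sign (k +ℕ suc k)     ≡⟨ cong (λ t → - sign t) (+-suc k k) ⟩
    - - sign (k +ℕ k)       ≈⟨ -‿involutive _ ⟩
    sign (k +ℕ k)          ≈⟨ sign-double k ⟩
    1#                     ∎
    where open ≈-Reasoning

  sign-+-double : ∀ k t → sign (k +ℕ (t +ℕ t)) ≈ sign k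
  sign-+-double k t = ≈-trans (sign-+ k (t +ℕ t)) (≈-trans (*-congˡ (sign-double t)) (*-identityʳ _))

  sign-nonzero : ¬ (1# ≈ 0#) → ∀ k → ¬ (sign k ≈ 0#)
  sign-nonzero 1≉0 k sign≈0 = 1≉0 (begin
    1#                  ≈⟨ sign-double k ⟨
    sign (k +ℕ k)       ≈⟨ sign-+ k k ⟩
    sign k * sign k     ≈⟨ *-congʳ sign≈0 ⟩
    0# * sign k         ≈⟨ zeroˡ _ ⟩
    0#                  ∎)
    where open ≈-Reasoning

  private variable
    I J : Set

  Σ-cong : (xs : List I) {f g : I → Carrier} → (∀ x → f x ≈ g x) → Σ[ xs ] f ≈ Σ[ xs ] g
  Σ-cong []       _   = ≈-refl
  Σ-cong (x ∷ xs) f≈g = +-cong (f≈g x) (Σ-cong xs f≈g)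

  Σ-zero : (xs : List I) {f : I → Carrier} → (∀ x → f x ≈ 0#) → Σ[ xs ] f ≈ 0#
  Σ-zero []       _   = ≈-refl
  Σ-zero (x ∷ xs) f≈0 = ≈-trans (+-cong (f≈0 x) (Σ-zero xs f≈0)) (+-identityˡ 0#)

  Σ-+ : (xs : List I) (f g : I → Carrier) → Σ[ xs ] (λ x → f x + g x) ≈ Σ[ xs ] f + Σ[ xs ] g
  Σ-+ []       f g = ≈-sym (+-identityˡ 0#)
  Σ-+ (x ∷ xs) f g = ≈-trans (+-congˡ (Σ-+ xs f g)) (+-interchange (f x) (g x) _ _)

  Σ-*ˡ : (a : Carrier) (xs : List I) (f : I → Carrier) → a * Σ[ xs ] f ≈ Σ[ xs ] (λ x → a * f x)
  Σ-*ˡ a []       f = zeroʳ a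
  Σ-*ˡ a (x ∷ xs) f = ≈-trans (distribˡ a (f x) _) (+-congˡ (Σ-*ˡ a xs f))

  Σ-*ʳ : (xs : List I) (f : I → Carrier) (a : Carrier) → Σ[ xs ] f * a ≈ Σ[ xs ] (λ x → f x * a)
  Σ-*ʳ xs f a = ≈-trans (*-comm _ a) (≈-trans (Σ-*ˡ a xs f) (Σ-cong xs (λ x → *-comm a (f x))))

  Σ-swap : (xs : List I) (ys : List J) (f : I → J → Carrier) →
           Σ[ xs ] (λ x → Σ[ ys ] (f x)) ≈ Σ[ ys ] (λ y → Σ[ xs ] (λ x → f x y))
  Σ-swap []       ys f = ≈-sym (Σ-zero ys (λ _ → ≈-refl))
  Σ-swap (x ∷ xs) ys f = ≈-trans (+-congˡ (Σ-swap xs ys f)) (≈-sym (Σ-+ ys (f x) _))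

  Σ-++ : (xs ys : List I) (f : I → Carrier) → Σ[ xs ++ ys ] f ≈ Σ[ xs ] f + Σ[ ys ] f
  Σ-++ []       ys f = ≈-sym (+-identityˡ _)
  Σ-++ (x ∷ xs) ys f = ≈-trans (+-congˡ (Σ-++ xs ys f)) (≈-sym (+-assoc _ _ _))

  Σ-map : (h : I → J) (xs : List I) (f : J → Carrier) → Σ[ map h xs ] f ≈ Σ[ xs ] (f ∘ h)
  Σ-map h []       f = ≈-refl
  Σ-map h (x ∷ xs) f = +-congˡ (Σ-map h xs f)

  Σ-tabulate-zero : ∀ {m} (h : Fin m → I) {f : I → Carrier} →
                    (∀ j → f (h j) ≈ 0#) → Σ[ tabulate h ] f ≈ 0#
  Σ-tabulate-zero {m = zero}  h _   = ≈-refl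
  Σ-tabulate-zero {m = suc m} h h≈0 =
    ≈-trans (+-cong (h≈0 zero) (Σ-tabulate-zero (h ∘ suc) (h≈0 ∘ suc))) (+-identityˡ 0#)

  Σ-δ-tabulate : ∀ {m} (g : Fin m → I) (f : I → Carrier) (j₀ : Fin m) →
                 (∀ j → j ≢ j₀ → f (g j) ≈ 0#) → Σ[ tabulate g ] f ≈ f (g j₀)
  Σ-δ-tabulate g f zero     off =
    ≈-trans (+-congˡ (Σ-tabulate-zero (g ∘ suc) (λ j → off (suc j) (λ ())))) (+-identityʳ _)
  Σ-δ-tabulate g f (suc j₀) off =
    ≈-trans (+-cong (off zero (λ ()))
                    (Σ-δ-tabulate (g ∘ suc) f j₀ (λ j j≢j₀ → off (suc j) (j≢j₀ ∘ Fin.suc-injective))))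
            (+-identityˡ _)

  Σ-allSubsets-suc : ∀ {m} (f : Subset (suc m) → Carrier) →
    Σ[ allSubsets (suc m) ] f ≈ Σ[ allSubsets m ] (f ∘ (inside ∷_)) + Σ[ allSubsets m ] (f ∘ (outside ∷_))
  Σ-allSubsets-suc {m} f =
    ≈-trans (Σ-++ (map (inside ∷_) (allSubsets m)) _ f)
            (+-cong (Σ-map (inside ∷_) (allSubsets m) f) (Σ-map (outside ∷_) (allSubsets m) f))

  Σ-δ-allSubsets : ∀ {m} (f : Subset m → Carrier) (X₀ : Subset m) →
                   (∀ X → X ≢ X₀ → f X ≈ 0#) → Σ[ allSubsets m ] f ≈ f X₀
  Σ-δ-allSubsets f []       _   = +-identityʳ _
  Σ-δ-allSubsets {suc m} f (inside ∷ X₀) off = ≈-trans (Σ-allSubsets-suc f)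
    (≈-trans (+-cong (Σ-δ-allSubsets (f ∘ (inside ∷_)) X₀ (λ X → off (inside ∷ X) ∘ (_∘ ∷-injectiveʳ)))
                     (Σ-zero (allSubsets m) (λ X → off (outside ∷ X) (λ ()))))
             (+-identityʳ _))
  Σ-δ-allSubsets {suc m} f (outside ∷ X₀) off = ≈-trans (Σ-allSubsets-suc f)
    (≈-trans (+-cong (Σ-zero (allSubsets m) (λ X → off (inside ∷ X) (λ ())))
                     (Σ-δ-allSubsets (f ∘ (outside ∷_)) X₀ (λ X → off (outside ∷ X) ∘ (_∘ ∷-injectiveʳ))))
             (+-identityˡ _))

  Σ-vanishes-or : ∀ {H : Set} (xs : List I) {f : I → Carrier} →
                  (∀ x → f x ≈ 0# ⊎ H) → Σ[ xs ] f ≈ 0# ⊎ H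
  Σ-vanishes-or []       _ = inj₁ ≈-refl
  Σ-vanishes-or (x ∷ xs) h with h x | Σ-vanishes-or xs h
  ... | inj₂ η  | _        = inj₂ η
  ... | inj₁ _  | inj₂ η   = inj₂ η
  ... | inj₁ p  | inj₁ q   = inj₁ (≈-trans (+-cong p q) (+-identityˡ 0#))

  -- The exterior product

  ℰ-setoid : Setoid c ℓ
  ℰ-setoid = record
    { Carrier       = ℰ
    ; _≈_           = _≈ℰ_
    ; isEquivalence = record
      { refl  = λ _ → ≈-refl
      ; sym   = λ a≈b X → ≈-sym (a≈b X)
      ; trans = λ a≈b b≈c X → ≈-trans (a≈b X) (b≈c X)
      }
    }

  module ℰ-Reasoning = SetoidReasoning ℰ-setoid
  open Setoid ℰ-setoid public using ()
    renaming (refl to ≈ℰ-refl; sym to ≈ℰ-sym; trans to ≈ℰ-trans; reflexive to ≈ℰ-reflexive)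

  infixr 7 _·ℰ_

  _·ℰ_ : Carrier → ℰ → ℰ
  (x ·ℰ a) Z = x * a Z

  Σℰ[_]_ : List I → (I → ℰ) → ℰ
  (Σℰ[ xs ] f) Z = Σ[ xs ] λ x → f x Z

  ·ℰ-cong : ∀ {x y a b} → x ≈ y → a ≈ℰ b → x ·ℰ a ≈ℰ y ·ℰ b
  ·ℰ-cong x≈y a≈b Z = *-cong x≈y (a≈b Z)

  Σℰ-cong : (xs : List I) {f g : I → ℰ} → (∀ x → f x ≈ℰ g x) → Σℰ[ xs ] f ≈ℰ Σℰ[ xs ] g
  Σℰ-cong xs f≈g Z = Σ-cong xs (λ x → f≈g x Z)

  e-diag : (X : Subset n) → e X X ≡ 1#
  e-diag X = cong (if_then 1# else 0#) (≟S-refl X)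

  e-≡ : {X Y : Subset n} → X ≡ Y → e X Y ≡ 1#
  e-≡ refl = e-diag _

  e-off : {X Y : Subset n} → X ≢ Y → e X Y ≡ 0#
  e-off X≢Y = cong (if_then 1# else 0#) (≟S-≢ X≢Y)

  basis-decomposition : (a : ℰ) → a ≈ℰ Σℰ[ allSubsets n ] (λ X → a X ·ℰ e X)
  basis-decomposition a Z = ≈-sym (begin
    Σ[ allSubsets n ] (λ X → a X * e X Z)
      ≈⟨ Σ-δ-allSubsets _ Z (λ X X≢Z → ≈-trans (*-congˡ (≈-reflexive (e-off X≢Z))) (zeroʳ _)) ⟩
    a Z * e Z Z  ≈⟨ *-congˡ (≈-reflexive (e-diag Z)) ⟩
    a Z * 1#     ≈⟨ *-identityʳ _ ⟩
    a Z          ∎)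
    where open ≈-Reasoning

  wedgeTerm : Subset n → Subset n → Carrier → Carrier
  wedgeTerm Z X x = if (X ∩ Z) ≟S X then sgn (inv X (Z ─ X)) x else 0#

  wedgeTerm-⊆ : ∀ {Z X} x → X ∩ Z ≡ X → wedgeTerm Z X x ≡ sgn (inv X (Z ─ X)) x
  wedgeTerm-⊆ {Z} {X} x X⊆Z =
    cong (if_then sgn (inv X (Z ─ X)) x else 0#) (trans (cong (_≟S X) X⊆Z) (≟S-refl X))

  wedgeTerm-⊈ : ∀ {Z X} x → X ∩ Z ≢ X → wedgeTerm Z X x ≡ 0#
  wedgeTerm-⊈ {Z} {X} x X⊈Z = cong (if_then sgn (inv X (Z ─ X)) x else 0#) (≟S-≢ X⊈Z)

  wedgeTerm-cong : ∀ Z X {x y} → x ≈ y → wedgeTerm Z X x ≈ wedgeTerm Z X y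
  wedgeTerm-cong Z X x≈y with (X ∩ Z) ≟S X
  ... | true  = sgn-cong (inv X (Z ─ X)) x≈y
  ... | false = ≈-refl

  wedgeTerm-zero : ∀ Z X → wedgeTerm Z X 0# ≈ 0#
  wedgeTerm-zero Z X with (X ∩ Z) ≟S X
  ... | true  = sgn-zero (inv X (Z ─ X))
  ... | false = ≈-refl

  wedgeTerm-*ˡ : ∀ Z X x y → wedgeTerm Z X (x * y) ≈ x * wedgeTerm Z X y
  wedgeTerm-*ˡ Z X x y with (X ∩ Z) ≟S X
  ... | true  = sgn-*ˡ (inv X (Z ─ X)) x y
  ... | false = ≈-sym (zeroʳ x)

  wedgeTerm-+ : ∀ Z X x y → wedgeTerm Z X (x + y) ≈ wedgeTerm Z X x + wedgeTerm Z X y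
  wedgeTerm-+ Z X x y with (X ∩ Z) ≟S X
  ... | true  = sgn-+ (inv X (Z ─ X)) x y
  ... | false = ≈-sym (+-identityˡ 0#)

  wedgeTerm-Σ : ∀ Z X (xs : List I) (f : I → Carrier) → wedgeTerm Z X (Σ[ xs ] f) ≈ Σ[ xs ] (wedgeTerm Z X ∘ f)
  wedgeTerm-Σ Z X []       f = wedgeTerm-zero Z X
  wedgeTerm-Σ Z X (x ∷ xs) f = ≈-trans (wedgeTerm-+ Z X (f x) _) (+-congˡ (wedgeTerm-Σ Z X xs f))

  ∧ℰ-cong : ∀ {a a′ b b′} → a ≈ℰ a′ → b ≈ℰ b′ → a ∧ℰ b ≈ℰ a′ ∧ℰ b′
  ∧ℰ-cong a≈a′ b≈b′ Z =
    Σ-cong (allSubsets n) λ X → wedgeTerm-cong Z X (*-cong (a≈a′ X) (b≈b′ (Z ─ X)))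

  ∧ℰ-congˡ : ∀ a {b b′} → b ≈ℰ b′ → a ∧ℰ b ≈ℰ a ∧ℰ b′
  ∧ℰ-congˡ a = ∧ℰ-cong {a = a} ≈ℰ-refl

  ∧ℰ-congʳ : ∀ b {a a′} → a ≈ℰ a′ → a ∧ℰ b ≈ℰ a′ ∧ℰ b
  ∧ℰ-congʳ b a≈a′ = ∧ℰ-cong a≈a′ (≈ℰ-refl {b})

  ∧ℰ-distribʳ-Σ : (xs : List I) (f : I → ℰ) (b : ℰ) →
                  (Σℰ[ xs ] f) ∧ℰ b ≈ℰ Σℰ[ xs ] (λ x → f x ∧ℰ b)
  ∧ℰ-distribʳ-Σ xs f b Z = ≈-trans
    (Σ-cong (allSubsets n) λ X → ≈-trans (wedgeTerm-cong Z X (Σ-*ʳ xs (λ x → f x X) _)) (wedgeTerm-Σ Z X xs _))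
    (Σ-swap (allSubsets n) xs _)

  ∧ℰ-distribˡ-Σ : (a : ℰ) (xs : List I) (f : I → ℰ) →
                  a ∧ℰ (Σℰ[ xs ] f) ≈ℰ Σℰ[ xs ] (λ x → a ∧ℰ f x)
  ∧ℰ-distribˡ-Σ a xs f Z = ≈-trans
    (Σ-cong (allSubsets n) λ X → ≈-trans (wedgeTerm-cong Z X (Σ-*ˡ (a X) xs _)) (wedgeTerm-Σ Z X xs _))
    (Σ-swap (allSubsets n) xs _)

  ∧ℰ-distribʳ-+ : (a a′ b : ℰ) → (a +ℰ a′) ∧ℰ b ≈ℰ (a ∧ℰ b) +ℰ (a′ ∧ℰ b)
  ∧ℰ-distribʳ-+ a a′ b Z = ≈-trans
    (Σ-cong (allSubsets n) λ X → ≈-trans (wedgeTerm-cong Z X (distribʳ _ (a X) (a′ X))) (wedgeTerm-+ Z X _ _))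
    (Σ-+ (allSubsets n) _ _)

  ∧ℰ-distribˡ-+ : (a b b′ : ℰ) → a ∧ℰ (b +ℰ b′) ≈ℰ (a ∧ℰ b) +ℰ (a ∧ℰ b′)
  ∧ℰ-distribˡ-+ a b b′ Z = ≈-trans
    (Σ-cong (allSubsets n) λ X → ≈-trans (wedgeTerm-cong Z X (distribˡ (a X) _ _)) (wedgeTerm-+ Z X _ _))
    (Σ-+ (allSubsets n) _ _)

  ∧ℰ-·ˡ : (x : Carrier) (a b : ℰ) → (x ·ℰ a) ∧ℰ b ≈ℰ x ·ℰ (a ∧ℰ b)
  ∧ℰ-·ˡ x a b Z = ≈-trans
    (Σ-cong (allSubsets n) λ X → ≈-trans (wedgeTerm-cong Z X (*-assoc x (a X) _)) (wedgeTerm-*ˡ Z X x _))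
    (≈-sym (Σ-*ˡ x (allSubsets n) _))

  ∧ℰ-·ʳ : (x : Carrier) (a b : ℰ) → a ∧ℰ (x ·ℰ b) ≈ℰ x ·ℰ (a ∧ℰ b)
  ∧ℰ-·ʳ x a b Z = ≈-trans
    (Σ-cong (allSubsets n) λ X → ≈-trans (wedgeTerm-cong Z X (x∙yz≈y∙xz (a X) x _)) (wedgeTerm-*ˡ Z X x _))
    (≈-sym (Σ-*ˡ x (allSubsets n) _))

  e-∧ℰ : (S : Subset n) (b : ℰ) (Z : Subset n) →
         (e S ∧ℰ b) Z ≈ wedgeTerm Z S (b (Z ─ S))
  e-∧ℰ S b Z = ≈-trans (Σ-δ-allSubsets _ S off)
    (wedgeTerm-cong Z S (≈-trans (*-congʳ (≈-reflexive (e-diag S))) (*-identityˡ _)))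
    where
    off : ∀ X → X ≢ S → wedgeTerm Z X (e S X * b (Z ─ X)) ≈ 0#
    off X X≢S = ≈-trans
      (wedgeTerm-cong Z X (≈-trans (*-congʳ (≈-reflexive (e-off (X≢S ∘ sym)))) (zeroˡ _)))
      (wedgeTerm-zero Z X)

  e-∧ℰ-⊆ : ∀ {S Z} (b : ℰ) → S ∩ Z ≡ S → (e S ∧ℰ b) Z ≈ sgn (inv S (Z ─ S)) (b (Z ─ S))
  e-∧ℰ-⊆ {S} {Z} b S⊆Z = ≈-trans (e-∧ℰ S b Z)
    (≈-reflexive (wedgeTerm-⊆ (b (Z ─ S)) S⊆Z))

  e-∧ℰ-⊈ : ∀ {S Z} (b : ℰ) → S ∩ Z ≢ S → (e S ∧ℰ b) Z ≈ 0#
  e-∧ℰ-⊈ {S} {Z} b S⊈Z = ≈-trans (e-∧ℰ S b Z)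
    (≈-reflexive (wedgeTerm-⊈ (b (Z ─ S)) S⊈Z))

  e-∧ℰ-e-vanishes : ∀ {S W Z} → (S ∩ Z ≡ S → W ≢ Z ─ S) → (e S ∧ℰ e W) Z ≈ 0#
  e-∧ℰ-e-vanishes {S} {W} {Z} h with ≡-dec Bool._≟_ (S ∩ Z) S
  ... | yes S⊆Z = ≈-trans (e-∧ℰ-⊆ (e W) S⊆Z)
    (≈-trans (sgn-cong (inv S (Z ─ S)) (≈-reflexive (e-off (h S⊆Z)))) (sgn-zero (inv S (Z ─ S))))
  ... | no  S⊈Z = e-∧ℰ-⊈ (e W) S⊈Z

  wedgeSign : Subset n → Subset n → Carrier
  wedgeSign S W = if (S ∩ W) ≟S ⊥ then sign (inv S W) else 0#

  wedgeSign-disjoint : ∀ {S W} → Disjoint S W → wedgeSign S W ≡ sign (inv S W)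
  wedgeSign-disjoint {S} {W} d = cong (if_then sign (inv S W) else 0#) (trans (cong (_≟S ⊥) d) (≟S-refl ⊥))

  wedgeSign-overlap : ∀ {S W} → ¬ Disjoint S W → wedgeSign S W ≡ 0#
  wedgeSign-overlap {S} {W} ¬d = cong (if_then sign (inv S W) else 0#) (≟S-≢ ¬d)

  e-∧ℰ-e : (S W : Subset n) → e S ∧ℰ e W ≈ℰ wedgeSign S W ·ℰ e (S ∪ W)
  e-∧ℰ-e S W Z = by-cases Z (≡-dec Bool._≟_ (S ∩ W) ⊥) (≡-dec Bool._≟_ (S ∪ W) Z)
    where
    by-cases : ∀ Z → Dec (Disjoint S W) → Dec (S ∪ W ≡ Z) → (e S ∧ℰ e W) Z ≈ wedgeSign S W * e (S ∪ W) Z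
    by-cases _ (yes d) (yes refl) = begin
      (e S ∧ℰ e W) (S ∪ W)                      ≈⟨ e-∧ℰ-⊆ (e W) (∩-abs-∪ S W) ⟩
      sgn (inv S (S ∪ W ─ S)) (e W (S ∪ W ─ S))
                                                ≡⟨ cong (λ T → sgn (inv S T) (e W T)) (p∪q─p≡q S W d) ⟩
      sgn (inv S W) (e W W)                     ≈⟨ sgn≈sign* (inv S W) (e W W) ⟩
      sign (inv S W) * e W W                    ≡⟨ cong₂ _*_ (sym (wedgeSign-disjoint d))
                                                             (trans (e-diag W) (sym (e-diag (S ∪ W)))) ⟩
      wedgeSign S W * e (S ∪ W) (S ∪ W)         ∎
      where open ≈-Reasoning
    by-cases Z (yes d) (no S∪W≢Z) = ≈-trans
      (e-∧ℰ-e-vanishes (λ S⊆Z W≡Z─S → S∪W≢Z (trans (cong (S ∪_) W≡Z─S) (p∪[q─p]≡q S Z S⊆Z))))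
      (≈-sym (≈-trans (*-congˡ (≈-reflexive (e-off S∪W≢Z))) (zeroʳ _)))
    by-cases Z (no ¬d) _ = ≈-trans
      (e-∧ℰ-e-vanishes (λ _ W≡Z─S → ¬d (trans (cong (S ∩_) W≡Z─S) (disjoint-─ S Z))))
      (≈-sym (≈-trans (*-congʳ (≈-reflexive (wedgeSign-overlap ¬d))) (zeroˡ _)))

  wedgeSign-*-vanishes : ∀ {S W S′ W′} → ¬ (Disjoint S W × Disjoint S′ W′) →
                         wedgeSign S W * wedgeSign S′ W′ ≈ 0#
  wedgeSign-*-vanishes {S} {W} {S′} {W′} ¬dd = by-cases (≡-dec Bool._≟_ (S ∩ W) ⊥)
    where
    by-cases : Dec (Disjoint S W) → wedgeSign S W * wedgeSign S′ W′ ≈ 0#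
    by-cases (no ¬d) = ≈-trans (*-congʳ (≈-reflexive (wedgeSign-overlap ¬d))) (zeroˡ _)
    by-cases (yes d) = ≈-trans (*-congˡ (≈-reflexive (wedgeSign-overlap (λ d′ → ¬dd (d , d′))))) (zeroʳ _)

  wedgeSign-assoc : (X Y W : Subset n) →
                    wedgeSign X Y * wedgeSign (X ∪ Y) W ≈ wedgeSign Y W * wedgeSign X (Y ∪ W)
  wedgeSign-assoc X Y W with ≡-dec Bool._≟_ (X ∩ Y) ⊥ ×-dec ≡-dec Bool._≟_ ((X ∪ Y) ∩ W) ⊥
  ... | no ¬dd = ≈-trans (wedgeSign-*-vanishes ¬dd)
                         (≈-sym (wedgeSign-*-vanishes (¬dd ∘ disjoint-reassocˡ X Y W)))
  ... | yes (d₁ , d₂) with disjoint-reassocʳ X Y W (d₁ , d₂)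
  ...   | e₁ , e₂ = begin
    wedgeSign X Y * wedgeSign (X ∪ Y) W       ≡⟨ cong₂ _*_ (wedgeSign-disjoint d₁) (wedgeSign-disjoint d₂) ⟩
    sign (inv X Y) * sign (inv (X ∪ Y) W)     ≈⟨ sign-+ (inv X Y) _ ⟨
    sign (inv X Y +ℕ inv (X ∪ Y) W)           ≡⟨ cong sign (inv-reassoc X Y W d₁ e₁) ⟩
    sign (inv Y W +ℕ inv X (Y ∪ W))           ≈⟨ sign-+ (inv Y W) _ ⟩
    sign (inv Y W) * sign (inv X (Y ∪ W))     ≡⟨ cong₂ _*_ (wedgeSign-disjoint e₁) (wedgeSign-disjoint e₂) ⟨
    wedgeSign Y W * wedgeSign X (Y ∪ W)       ∎
    where open ≈-Reasoning

  e-∧ℰ-assoc : (X Y W : Subset n) → (e X ∧ℰ e Y) ∧ℰ e W ≈ℰ e X ∧ℰ (e Y ∧ℰ e W)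
  e-∧ℰ-assoc X Y W = begin
    (e X ∧ℰ e Y) ∧ℰ e W
      ≈⟨ ∧ℰ-congʳ (e W) (e-∧ℰ-e X Y) ⟩
    (wedgeSign X Y ·ℰ e (X ∪ Y)) ∧ℰ e W
      ≈⟨ ≈ℰ-trans (∧ℰ-·ˡ (wedgeSign X Y) (e (X ∪ Y)) (e W)) (·ℰ-cong ≈-refl (e-∧ℰ-e (X ∪ Y) W)) ⟩
    wedgeSign X Y ·ℰ (wedgeSign (X ∪ Y) W ·ℰ e ((X ∪ Y) ∪ W))
      ≈⟨ scalars ⟩
    wedgeSign Y W ·ℰ (wedgeSign X (Y ∪ W) ·ℰ e (X ∪ (Y ∪ W)))
      ≈⟨ ≈ℰ-trans (∧ℰ-·ʳ (wedgeSign Y W) (e X) (e (Y ∪ W))) (·ℰ-cong ≈-refl (e-∧ℰ-e X (Y ∪ W))) ⟨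
    e X ∧ℰ (wedgeSign Y W ·ℰ e (Y ∪ W))
      ≈⟨ ∧ℰ-congˡ (e X) (e-∧ℰ-e Y W) ⟨
    e X ∧ℰ (e Y ∧ℰ e W) ∎
    where
    open ℰ-Reasoning
    scalars : wedgeSign X Y ·ℰ (wedgeSign (X ∪ Y) W ·ℰ e ((X ∪ Y) ∪ W))
           ≈ℰ wedgeSign Y W ·ℰ (wedgeSign X (Y ∪ W) ·ℰ e (X ∪ (Y ∪ W)))
    scalars Z = ≈-trans (≈-sym (*-assoc _ _ _))
      (≈-trans (*-cong (wedgeSign-assoc X Y W) (≈-reflexive (cong (λ T → e T Z) (∪-assoc X Y W))))
               (*-assoc _ _ _))

  record IsLinear (F : ℰ → ℰ) : Set (c ⊔ ℓ) where
    field
      ℰ-cong : ∀ {a b} → a ≈ℰ b → F a ≈ℰ F b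
      Σ-homo : (f : Subset n → ℰ) → F (Σℰ[ allSubsets n ] f) ≈ℰ Σℰ[ allSubsets n ] (F ∘ f)
      ·-homo : ∀ x a → F (x ·ℰ a) ≈ℰ x ·ℰ F a

  linear-ext : ∀ {F G} → IsLinear F → IsLinear G → (∀ X → F (e X) ≈ℰ G (e X)) → ∀ a → F a ≈ℰ G a
  linear-ext {F} {G} F-lin G-lin F≈G a = begin
    F a                                              ≈⟨ L.ℰ-cong F-lin (basis-decomposition a) ⟩
    F (Σℰ[ allSubsets n ] (λ X → a X ·ℰ e X))        ≈⟨ L.Σ-homo F-lin _ ⟩
    Σℰ[ allSubsets n ] (λ X → F (a X ·ℰ e X))        ≈⟨ Σℰ-cong (allSubsets n) on-basis ⟩
    Σℰ[ allSubsets n ] (λ X → G (a X ·ℰ e X))        ≈⟨ L.Σ-homo G-lin _ ⟨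
    G (Σℰ[ allSubsets n ] (λ X → a X ·ℰ e X))        ≈⟨ L.ℰ-cong G-lin (basis-decomposition a) ⟨
    G a                                              ∎
    where
    open ℰ-Reasoning
    module L = IsLinear
    on-basis : ∀ X → F (a X ·ℰ e X) ≈ℰ G (a X ·ℰ e X)
    on-basis X = ≈ℰ-trans (L.·-homo F-lin (a X) (e X))
                  (≈ℰ-trans (·ℰ-cong ≈-refl (F≈G X)) (≈ℰ-sym (L.·-homo G-lin (a X) (e X))))

  id-linear : IsLinear (λ a → a)
  id-linear = record { ℰ-cong = λ a≈b → a≈b ; Σ-homo = λ _ → ≈ℰ-refl ; ·-homo = λ _ _ → ≈ℰ-refl }

  ∘-linear : ∀ {F G} → IsLinear F → IsLinear G → IsLinear (F ∘ G)
  ∘-linear {F} {G} F-lin G-lin = record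
    { ℰ-cong = L.ℰ-cong F-lin ∘ L.ℰ-cong G-lin
    ; Σ-homo = λ f → ≈ℰ-trans (L.ℰ-cong F-lin (L.Σ-homo G-lin f)) (L.Σ-homo F-lin (G ∘ f))
    ; ·-homo = λ x a → ≈ℰ-trans (L.ℰ-cong F-lin (L.·-homo G-lin x a)) (L.·-homo F-lin x (G a))
    }
    where module L = IsLinear

  ∧ℰ-linearˡ : (a : ℰ) → IsLinear (a ∧ℰ_)
  ∧ℰ-linearˡ a = record
    { ℰ-cong = ∧ℰ-congˡ a
    ; Σ-homo = ∧ℰ-distribˡ-Σ a (allSubsets n)
    ; ·-homo = λ x b → ∧ℰ-·ʳ x a b
    }

  ∧ℰ-linearʳ : (b : ℰ) → IsLinear (_∧ℰ b)
  ∧ℰ-linearʳ b = record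
    { ℰ-cong = ∧ℰ-congʳ b
    ; Σ-homo = λ f → ∧ℰ-distribʳ-Σ (allSubsets n) f b
    ; ·-homo = λ x a → ∧ℰ-·ˡ x a b
    }

  ∧ℰ-assoc : (a b c : ℰ) → (a ∧ℰ b) ∧ℰ c ≈ℰ a ∧ℰ (b ∧ℰ c)
  ∧ℰ-assoc a b c =
    linear-ext (∘-linear (∧ℰ-linearʳ c) (∧ℰ-linearʳ b)) (∧ℰ-linearʳ (b ∧ℰ c)) (λ X → e-∧ℰ-·-∧ℰ-c X b) a
    where
    e-∧ℰ-e-∧ℰ-c : ∀ X Y → (e X ∧ℰ e Y) ∧ℰ c ≈ℰ e X ∧ℰ (e Y ∧ℰ c)
    e-∧ℰ-e-∧ℰ-c X Y =
      linear-ext (∧ℰ-linearˡ (e X ∧ℰ e Y)) (∘-linear (∧ℰ-linearˡ (e X)) (∧ℰ-linearˡ (e Y))) (e-∧ℰ-assoc X Y) c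
    e-∧ℰ-·-∧ℰ-c : ∀ X b → (e X ∧ℰ b) ∧ℰ c ≈ℰ e X ∧ℰ (b ∧ℰ c)
    e-∧ℰ-·-∧ℰ-c X =
      linear-ext (∘-linear (∧ℰ-linearʳ c) (∧ℰ-linearˡ (e X))) (∘-linear (∧ℰ-linearˡ (e X)) (∧ℰ-linearʳ c))
                 (e-∧ℰ-e-∧ℰ-c X)

  e-⊥-∧ℰ-e : (X : Subset n) → e ⊥ ∧ℰ e X ≈ℰ e X
  e-⊥-∧ℰ-e X Z = ≈-trans (e-∧ℰ-e ⊥ X Z) (begin
    wedgeSign ⊥ X * e (⊥ ∪ X) Z     ≡⟨ cong₂ _*_ (wedgeSign-disjoint (∩-zeroˡ X))
                                                 (cong (λ T → e T Z) (∪-identityˡ X)) ⟩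
    sign (inv ⊥ X) * e X Z          ≡⟨ cong (λ k → sign k * e X Z) (inv-⊥ˡ X) ⟩
    1# * e X Z                      ≈⟨ *-identityˡ _ ⟩
    e X Z                           ∎)
    where open ≈-Reasoning

  e-∧ℰ-e-⊥ : (X : Subset n) → e X ∧ℰ e ⊥ ≈ℰ e X
  e-∧ℰ-e-⊥ X Z = ≈-trans (e-∧ℰ-e X ⊥ Z) (begin
    wedgeSign X ⊥ * e (X ∪ ⊥) Z     ≡⟨ cong₂ _*_ (wedgeSign-disjoint (∩-zeroʳ X))
                                                 (cong (λ T → e T Z) (∪-identityʳ X)) ⟩
    sign (inv X ⊥) * e X Z          ≡⟨ cong (λ k → sign k * e X Z) (inv-⊥ʳ X) ⟩
    1# * e X Z                      ≈⟨ *-identityˡ _ ⟩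
    e X Z                           ∎)
    where open ≈-Reasoning

  ∧ℰ-identityˡ : (a : ℰ) → e ⊥ ∧ℰ a ≈ℰ a
  ∧ℰ-identityˡ = linear-ext (∧ℰ-linearˡ (e ⊥)) id-linear e-⊥-∧ℰ-e

  -- The derivation ∂

  ∂-cong : ∀ {a b} → a ≈ℰ b → ∂ a ≈ℰ ∂ b
  ∂-cong {a} {b} a≈b Y = Σ-cong (allFin n) summand
    where
    summand : ∀ i → (if lookup Y i then 0# else sgn (inv ⁅ i ⁆ Y) (a (Y ∪ ⁅ i ⁆)))
                  ≈ (if lookup Y i then 0# else sgn (inv ⁅ i ⁆ Y) (b (Y ∪ ⁅ i ⁆)))
    summand i with lookup Y i
    ... | true  = ≈-refl
    ... | false = sgn-cong (inv ⁅ i ⁆ Y) (a≈b (Y ∪ ⁅ i ⁆))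

  ∂-· : (x : Carrier) (a : ℰ) → ∂ (x ·ℰ a) ≈ℰ x ·ℰ ∂ a
  ∂-· x a Y = ≈-trans (Σ-cong (allFin n) summand) (≈-sym (Σ-*ˡ x (allFin n) _))
    where
    summand : ∀ i → (if lookup Y i then 0# else sgn (inv ⁅ i ⁆ Y) (x * a (Y ∪ ⁅ i ⁆)))
                  ≈ x * (if lookup Y i then 0# else sgn (inv ⁅ i ⁆ Y) (a (Y ∪ ⁅ i ⁆)))
    summand i with lookup Y i
    ... | true  = ≈-sym (zeroʳ x)
    ... | false = sgn-*ˡ (inv ⁅ i ⁆ Y) x _

  ∂coeff : Subset n → Fin n → Carrier
  ∂coeff D j = if lookup D j then sign (inv ⁅ j ⁆ (D - j)) else 0#

  ∂coeff-∈ : ∀ D j → lookup D j ≡ true → ∂coeff D j ≡ sign (inv ⁅ j ⁆ (D - j))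
  ∂coeff-∈ D j Dj = cong (if_then sign (inv ⁅ j ⁆ (D - j)) else 0#) Dj

  ∂coeff-∉ : ∀ D j → lookup D j ≡ false → ∂coeff D j ≡ 0#
  ∂coeff-∉ D j Dj = cong (if_then sign (inv ⁅ j ⁆ (D - j)) else 0#) Dj

  ∂-e : (D : Subset n) → ∂ (e D) ≈ℰ Σℰ[ allFin n ] (λ j → ∂coeff D j ·ℰ e (D - j))
  ∂-e D W = Σ-cong (allFin n) summand
    where
    summand : ∀ j → (if lookup W j then 0# else sgn (inv ⁅ j ⁆ W) (e D (W ∪ ⁅ j ⁆)))
                    ≈ ∂coeff D j * e (D - j) W
    summand j with lookup W j in Wj | lookup D j in Dj
    ... | true  | true  = ≈-sym (≈-trans (*-congˡ (≈-reflexive (e-off (≢-at j (x∉p-xᵇ D j) Wj)))) (zeroʳ _))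
    ... | true  | false = ≈-sym (zeroˡ _)
    ... | false | false = ≈-trans (sgn-cong (inv ⁅ j ⁆ W) (≈-reflexive (e-off (≢-at j Dj (x∈p∪⁅x⁆ᵇ W j)))))
                                  (≈-trans (sgn-zero (inv ⁅ j ⁆ W)) (≈-sym (zeroˡ _)))
    ... | false | true  = removed j Wj Dj (≡-dec Bool._≟_ (D - j) W)
      where
      removed : ∀ j → lookup W j ≡ false → lookup D j ≡ true → Dec (D - j ≡ W) →
                sgn (inv ⁅ j ⁆ W) (e D (W ∪ ⁅ j ⁆)) ≈ sign (inv ⁅ j ⁆ (D - j)) * e (D - j) W
      removed j Wj Dj (yes D-j≡W) = begin
        sgn (inv ⁅ j ⁆ W) (e D (W ∪ ⁅ j ⁆))  ≡⟨ cong (sgn (inv ⁅ j ⁆ W))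
                                                    (e-≡ (sym (trans (cong (_∪ ⁅ j ⁆) (sym D-j≡W)) (p-x∪⁅x⁆≡p D j Dj)))) ⟩
        sgn (inv ⁅ j ⁆ W) 1#                 ≈⟨ *-identityʳ _ ⟨
        sign (inv ⁅ j ⁆ W) * 1#              ≡⟨ cong₂ (λ T v → sign (inv ⁅ j ⁆ T) * v) (sym D-j≡W) (sym (e-≡ D-j≡W)) ⟩
        sign (inv ⁅ j ⁆ (D - j)) * e (D - j) W ∎
        where open ≈-Reasoning
      removed j Wj Dj (no D-j≢W) = ≈-trans
        (sgn-cong (inv ⁅ j ⁆ W)
                  (≈-reflexive (e-off λ D≡W∪j → D-j≢W (trans (cong (_- j) D≡W∪j) (p∪⁅x⁆-x≡p W j Wj)))))
        (≈-trans (sgn-zero (inv ⁅ j ⁆ W)) (≈-sym (≈-trans (*-congˡ (≈-reflexive (e-off D-j≢W))) (zeroʳ _))))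

  ∂-e-⁅⁆ : (i : Fin n) → ∂ (e ⁅ i ⁆) ≈ℰ e ⊥
  ∂-e-⁅⁆ i Z = ≈-trans (∂-e ⁅ i ⁆ Z) (≈-trans (Σ-δ-tabulate (λ j → j) _ i off) (begin
    ∂coeff ⁅ i ⁆ i * e (⁅ i ⁆ - i) Z         ≡⟨ cong₂ _*_ (∂coeff-∈ ⁅ i ⁆ i (x∈⁅x⁆ᵇ i))
                                                          (cong (λ T → e T Z) (⁅x⁆-x≡⊥ i)) ⟩
    sign (inv ⁅ i ⁆ (⁅ i ⁆ - i)) * e ⊥ Z     ≡⟨ cong (λ T → sign (inv ⁅ i ⁆ T) * e ⊥ Z) (⁅x⁆-x≡⊥ i) ⟩
    sign (inv ⁅ i ⁆ ⊥) * e ⊥ Z               ≡⟨ cong (λ k → sign k * e ⊥ Z) (inv-⊥ʳ ⁅ i ⁆) ⟩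
    1# * e ⊥ Z                               ≈⟨ *-identityˡ _ ⟩
    e ⊥ Z                                    ∎))
    where
    open ≈-Reasoning
    off : ∀ j → j ≢ i → ∂coeff ⁅ i ⁆ j * e (⁅ i ⁆ - j) Z ≈ 0#
    off j j≢i = ≈-trans (*-congʳ (≈-reflexive (∂coeff-∉ ⁅ i ⁆ j (y∉⁅x⁆ᵇ j≢i)))) (zeroˡ _)

  ∂-e-at-removal : (C : Subset n) (c : Fin n) → lookup C c ≡ true →
                   ∂ (e C) (C - c) ≈ sign (inv ⁅ c ⁆ (C - c))
  ∂-e-at-removal C c Cc = ≈-trans (∂-e C (C - c)) (≈-trans (Σ-δ-tabulate (λ j → j) _ c off) (begin
    ∂coeff C c * e (C - c) (C - c)     ≡⟨ cong₂ _*_ (∂coeff-∈ C c Cc) (e-diag (C - c)) ⟩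
    sign (inv ⁅ c ⁆ (C - c)) * 1#      ≈⟨ *-identityʳ _ ⟩
    sign (inv ⁅ c ⁆ (C - c))           ∎))
    where
    open ≈-Reasoning
    off : ∀ j → j ≢ c → ∂coeff C j * e (C - j) (C - c) ≈ 0#
    off j j≢c =
      ≈-trans (*-congˡ (≈-reflexive (e-off (≢-at c (x∉p-xᵇ C c) (x∈p-yᵇ C Cc (j≢c ∘ sym)) ∘ sym)))) (zeroʳ _)

  ∂e-∧ℰ-e : (X Y : Subset n) →
            ∂ (e X) ∧ℰ e Y ≈ℰ Σℰ[ allFin n ] (λ j → ∂coeff X j ·ℰ (wedgeSign (X - j) Y ·ℰ e ((X - j) ∪ Y)))
  ∂e-∧ℰ-e X Y = begin
    ∂ (e X) ∧ℰ e Y                                           ≈⟨ ∧ℰ-congʳ (e Y) (∂-e X) ⟩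
    (Σℰ[ allFin n ] (λ j → ∂coeff X j ·ℰ e (X - j))) ∧ℰ e Y
      ≈⟨ ∧ℰ-distribʳ-Σ (allFin n) (λ j → ∂coeff X j ·ℰ e (X - j)) (e Y) ⟩
    Σℰ[ allFin n ] (λ j → (∂coeff X j ·ℰ e (X - j)) ∧ℰ e Y)  ≈⟨ Σℰ-cong (allFin n) wedge-each ⟩
    Σℰ[ allFin n ] (λ j → ∂coeff X j ·ℰ (wedgeSign (X - j) Y ·ℰ e ((X - j) ∪ Y))) ∎
    where
    open ℰ-Reasoning
    wedge-each : ∀ j → (∂coeff X j ·ℰ e (X - j)) ∧ℰ e Y
                       ≈ℰ ∂coeff X j ·ℰ (wedgeSign (X - j) Y ·ℰ e ((X - j) ∪ Y))
    wedge-each j = ≈ℰ-trans (∧ℰ-·ˡ (∂coeff X j) (e (X - j)) (e Y)) (·ℰ-cong ≈-refl (e-∧ℰ-e (X - j) Y))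

  e-∧ℰ-∂e : (X Y : Subset n) →
            e X ∧ℰ ∂ (e Y) ≈ℰ Σℰ[ allFin n ] (λ j → ∂coeff Y j ·ℰ (wedgeSign X (Y - j) ·ℰ e (X ∪ (Y - j))))
  e-∧ℰ-∂e X Y = begin
    e X ∧ℰ ∂ (e Y)                                           ≈⟨ ∧ℰ-congˡ (e X) (∂-e Y) ⟩
    e X ∧ℰ (Σℰ[ allFin n ] (λ j → ∂coeff Y j ·ℰ e (Y - j)))
      ≈⟨ ∧ℰ-distribˡ-Σ (e X) (allFin n) (λ j → ∂coeff Y j ·ℰ e (Y - j)) ⟩
    Σℰ[ allFin n ] (λ j → e X ∧ℰ (∂coeff Y j ·ℰ e (Y - j)))  ≈⟨ Σℰ-cong (allFin n) wedge-each ⟩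
    Σℰ[ allFin n ] (λ j → ∂coeff Y j ·ℰ (wedgeSign X (Y - j) ·ℰ e (X ∪ (Y - j)))) ∎
    where
    open ℰ-Reasoning
    wedge-each : ∀ j → e X ∧ℰ (∂coeff Y j ·ℰ e (Y - j))
                       ≈ℰ ∂coeff Y j ·ℰ (wedgeSign X (Y - j) ·ℰ e (X ∪ (Y - j)))
    wedge-each j = ≈ℰ-trans (∧ℰ-·ʳ (∂coeff Y j) (e X) (e (Y - j))) (·ℰ-cong ≈-refl (e-∧ℰ-e X (Y - j)))

  ∂-e-∧ℰ-e : (S W : Subset n) → ∂ (e S ∧ℰ e W) ≈ℰ wedgeSign S W ·ℰ ∂ (e (S ∪ W))
  ∂-e-∧ℰ-e S W = ≈ℰ-trans (∂-cong (e-∧ℰ-e S W)) (∂-· (wedgeSign S W) (e (S ∪ W)))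

  leibniz-signˡ : (X Y : Subset n) (j : Fin n) → Disjoint X Y → lookup X j ≡ true →
                  sign (inv X Y) * sign (inv ⁅ j ⁆ ((X - j) ∪ Y)) ≈
                  sign (inv ⁅ j ⁆ (X - j)) * sign (inv (X - j) Y)
  leibniz-signˡ X Y j d Xj = begin
    sign (inv X Y) * sign (inv ⁅ j ⁆ ((X - j) ∪ Y))             ≈⟨ sign-+ (inv X Y) _ ⟨
    sign (inv X Y +ℕ inv ⁅ j ⁆ ((X - j) ∪ Y))                   ≡⟨ cong sign (inv-leibnizˡ X Y j d Xj) ⟩
    sign ((inv ⁅ j ⁆ (X - j) +ℕ inv (X - j) Y) +ℕ (t +ℕ t))     ≈⟨ sign-+-double (inv ⁅ j ⁆ (X - j) +ℕ inv (X - j) Y) t ⟩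
    sign (inv ⁅ j ⁆ (X - j) +ℕ inv (X - j) Y)                   ≈⟨ sign-+ (inv ⁅ j ⁆ (X - j)) _ ⟩
    sign (inv ⁅ j ⁆ (X - j)) * sign (inv (X - j) Y)             ∎
    where
    open ≈-Reasoning
    t = inv ⁅ j ⁆ Y

  leibniz-signʳ : (X Y : Subset n) (j : Fin n) → Disjoint X Y → lookup X j ≡ false → lookup Y j ≡ true →
                  sign (inv X Y) * sign (inv ⁅ j ⁆ (X ∪ (Y - j))) ≈
                  sign ∣ X ∣ * (sign (inv ⁅ j ⁆ (Y - j)) * sign (inv X (Y - j)))
  leibniz-signʳ X Y j d Xj Yj = begin
    sign (inv X Y) * sign (inv ⁅ j ⁆ (X ∪ (Y - j)))                  ≈⟨ sign-+ (inv X Y) _ ⟨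
    sign (inv X Y +ℕ inv ⁅ j ⁆ (X ∪ (Y - j)))                        ≡⟨ cong sign (inv-leibnizʳ X Y j d Xj Yj) ⟩
    sign (∣ X ∣ +ℕ (inv ⁅ j ⁆ (Y - j) +ℕ inv X (Y - j)))             ≈⟨ sign-+ ∣ X ∣ _ ⟩
    sign ∣ X ∣ * sign (inv ⁅ j ⁆ (Y - j) +ℕ inv X (Y - j))           ≈⟨ *-congˡ (sign-+ (inv ⁅ j ⁆ (Y - j)) _) ⟩
    sign ∣ X ∣ * (sign (inv ⁅ j ⁆ (Y - j)) * sign (inv X (Y - j)))   ∎
    where open ≈-Reasoning

  ∂-leibniz-e : (X Y : Subset n) → Disjoint X Y →
                ∂ (e X ∧ℰ e Y) ≈ℰ (∂ (e X) ∧ℰ e Y) +ℰ (sign ∣ X ∣ ·ℰ (e X ∧ℰ ∂ (e Y)))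
  ∂-leibniz-e X Y d Z = begin
    ∂ (e X ∧ℰ e Y) Z
      ≈⟨ ∂-e-∧ℰ-e X Y Z ⟩
    wedgeSign X Y * ∂ (e (X ∪ Y)) Z
      ≈⟨ *-congˡ (∂-e (X ∪ Y) Z) ⟩
    wedgeSign X Y * Σ[ allFin n ] (λ j → ∂coeff (X ∪ Y) j * e (X ∪ Y - j) Z)
      ≈⟨ Σ-*ˡ (wedgeSign X Y) (allFin n) _ ⟩
    Σ[ allFin n ] (λ j → wedgeSign X Y * (∂coeff (X ∪ Y) j * e (X ∪ Y - j) Z))
      ≈⟨ Σ-cong (allFin n) (λ j → term j (lookup X j) (lookup Y j) refl refl) ⟩
    Σ[ allFin n ] (λ j → R₁ j + sign ∣ X ∣ * R₂ j)
      ≈⟨ Σ-+ (allFin n) R₁ _ ⟩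
    Σ[ allFin n ] R₁ + Σ[ allFin n ] (λ j → sign ∣ X ∣ * R₂ j)
      ≈⟨ +-congˡ (Σ-*ˡ (sign ∣ X ∣) (allFin n) R₂) ⟨
    Σ[ allFin n ] R₁ + sign ∣ X ∣ * Σ[ allFin n ] R₂
      ≈⟨ +-cong (∂e-∧ℰ-e X Y Z) (*-congˡ (e-∧ℰ-∂e X Y Z)) ⟨
    (∂ (e X) ∧ℰ e Y) Z + sign ∣ X ∣ * (e X ∧ℰ ∂ (e Y)) Z ∎
    where
    open ≈-Reasoning
    R₁ R₂ : Fin n → Carrier
    R₁ j = ∂coeff X j * (wedgeSign (X - j) Y * e ((X - j) ∪ Y) Z)
    R₂ j = ∂coeff Y j * (wedgeSign X (Y - j) * e (X ∪ (Y - j)) Z)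
    vanishes : ∀ D j {x} → lookup D j ≡ false → ∂coeff D j * x ≈ 0#
    vanishes D j Dj = ≈-trans (*-congʳ (≈-reflexive (∂coeff-∉ D j Dj))) (zeroˡ _)
    term : ∀ j x y → lookup X j ≡ x → lookup Y j ≡ y →
           wedgeSign X Y * (∂coeff (X ∪ Y) j * e (X ∪ Y - j) Z) ≈ R₁ j + sign ∣ X ∣ * R₂ j
    term j true true Xj Yj with () ← trans (sym (disjoint-∉ᵇ X Y j d Xj)) Yj
    term j true false Xj Yj = begin
      wedgeSign X Y * (∂coeff (X ∪ Y) j * e (X ∪ Y - j) Z)
        ≡⟨ cong₂ _*_ (wedgeSign-disjoint d) (cong₂ _*_ (∂coeff-∈ (X ∪ Y) j (x∈p⇒x∈p∪qᵇ X Y j Xj)) refl) ⟩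
      sign (inv X Y) * (sign (inv ⁅ j ⁆ (X ∪ Y - j)) * e (X ∪ Y - j) Z)
        ≡⟨ cong (λ T → sign (inv X Y) * (sign (inv ⁅ j ⁆ T) * e T Z)) (p∪q-x≡[p-x]∪q X Y j Yj) ⟩
      sign (inv X Y) * (sign (inv ⁅ j ⁆ ((X - j) ∪ Y)) * e ((X - j) ∪ Y) Z)
        ≈⟨ *-assoc-cong _ (leibniz-signˡ X Y j d Xj) ⟩
      (sign (inv ⁅ j ⁆ (X - j)) * sign (inv (X - j) Y)) * e ((X - j) ∪ Y) Z
        ≈⟨ *-assoc _ _ _ ⟩
      sign (inv ⁅ j ⁆ (X - j)) * (sign (inv (X - j) Y) * e ((X - j) ∪ Y) Z)
        ≡⟨ cong₂ (λ s t → s * (t * e ((X - j) ∪ Y) Z)) (sym (∂coeff-∈ X j Xj))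
                                                       (sym (wedgeSign-disjoint (disjoint-─ˡ X Y ⁅ j ⁆ d))) ⟩
      R₁ j
        ≈⟨ +-identityʳ (R₁ j) ⟨
      R₁ j + 0#
        ≈⟨ +-congˡ (≈-trans (*-congˡ (vanishes Y j Yj)) (zeroʳ _)) ⟨
      R₁ j + sign ∣ X ∣ * R₂ j ∎
    term j false true Xj Yj = begin
      wedgeSign X Y * (∂coeff (X ∪ Y) j * e (X ∪ Y - j) Z)
        ≡⟨ cong₂ _*_ (wedgeSign-disjoint d) (cong₂ _*_ (∂coeff-∈ (X ∪ Y) j (x∈q⇒x∈p∪qᵇ X Y j Yj)) refl) ⟩
      sign (inv X Y) * (sign (inv ⁅ j ⁆ (X ∪ Y - j)) * e (X ∪ Y - j) Z)
        ≡⟨ cong (λ T → sign (inv X Y) * (sign (inv ⁅ j ⁆ T) * e T Z)) (p∪q-x≡p∪[q-x] X Y j Xj) ⟩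
      sign (inv X Y) * (sign (inv ⁅ j ⁆ (X ∪ (Y - j))) * e (X ∪ (Y - j)) Z)
        ≈⟨ *-assoc-cong _ (leibniz-signʳ X Y j d Xj Yj) ⟩
      (sign ∣ X ∣ * (sign (inv ⁅ j ⁆ (Y - j)) * sign (inv X (Y - j)))) * e (X ∪ (Y - j)) Z
        ≈⟨ ≈-trans (*-assoc _ _ _) (*-congˡ (*-assoc _ _ _)) ⟩
      sign ∣ X ∣ * (sign (inv ⁅ j ⁆ (Y - j)) * (sign (inv X (Y - j)) * e (X ∪ (Y - j)) Z))
        ≡⟨ cong₂ (λ s t → sign ∣ X ∣ * (s * (t * e (X ∪ (Y - j)) Z))) (sym (∂coeff-∈ Y j Yj))
                                                                  (sym (wedgeSign-disjoint (disjoint-─ʳ X Y ⁅ j ⁆ d))) ⟩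
      sign ∣ X ∣ * R₂ j
        ≈⟨ +-identityˡ _ ⟨
      0# + sign ∣ X ∣ * R₂ j
        ≈⟨ +-congʳ (vanishes X j Xj) ⟨
      R₁ j + sign ∣ X ∣ * R₂ j ∎
    term j false false Xj Yj = begin
      wedgeSign X Y * (∂coeff (X ∪ Y) j * e (X ∪ Y - j) Z)  ≈⟨ *-congˡ (vanishes (X ∪ Y) j (x∉p∪qᵇ X Y j Xj Yj)) ⟩
      wedgeSign X Y * 0#                                    ≈⟨ zeroʳ _ ⟩
      0#                                                    ≈⟨ +-identityʳ 0# ⟨
      0# + 0#
        ≈⟨ +-cong (vanishes X j Xj) (≈-trans (*-congˡ (vanishes Y j Yj)) (zeroʳ _)) ⟨
      R₁ j + sign ∣ X ∣ * R₂ j                              ∎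

  ∂-∧ℰ-split : (A B : Subset n) (i : Fin n) →
               Disjoint A ⁅ i ⁆ → Disjoint ⁅ i ⁆ B → Disjoint A B →
               ∂ (e A ∧ℰ e B) ≈ℰ (∂ (e A ∧ℰ e ⁅ i ⁆) ∧ℰ ∂ (e B)) +ℰ (∂ (e A) ∧ℰ ∂ (e ⁅ i ⁆ ∧ℰ e B))
  ∂-∧ℰ-split A B i dAi diB dAB Z = begin
    ∂ (e A ∧ℰ e B) Z
      ≈⟨ ∂-leibniz-e A B dAB Z ⟩
    w + v
      ≈⟨ cancel ⟩
    (u + v) + (w + sign 1 * u′)
      ≈⟨ +-cong (+-congˡ (∧ℰ-·ˡ (sign ∣ A ∣) a (∂ b) Z)) (+-congˡ (∧ℰ-·ʳ (sign 1) (∂ a) (z ∧ℰ ∂ b) Z)) ⟨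
    (u + ((sign ∣ A ∣ ·ℰ a) ∧ℰ ∂ b) Z) + (w + (∂ a ∧ℰ (sign 1 ·ℰ (z ∧ℰ ∂ b))) Z)
      ≈⟨ +-cong (∧ℰ-distribʳ-+ (∂ a ∧ℰ z) (sign ∣ A ∣ ·ℰ a) (∂ b) Z)
                (∧ℰ-distribˡ-+ (∂ a) b (sign 1 ·ℰ (z ∧ℰ ∂ b)) Z) ⟨
    (((∂ a ∧ℰ z) +ℰ (sign ∣ A ∣ ·ℰ a)) ∧ℰ ∂ b) Z + (∂ a ∧ℰ (b +ℰ (sign 1 ·ℰ (z ∧ℰ ∂ b)))) Z
      ≈⟨ +-cong (∧ℰ-congʳ (∂ b) ∂[a∧z] Z) (∧ℰ-congˡ (∂ a) ∂[z∧b] Z) ⟨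
    (∂ (a ∧ℰ z) ∧ℰ ∂ b) Z + (∂ a ∧ℰ ∂ (z ∧ℰ b)) Z ∎
    where
    open ≈-Reasoning
    a = e A
    b = e B
    z = e ⁅ i ⁆
    u  = ((∂ a ∧ℰ z) ∧ℰ ∂ b) Z
    u′ = (∂ a ∧ℰ (z ∧ℰ ∂ b)) Z
    v  = sign ∣ A ∣ * (a ∧ℰ ∂ b) Z
    w  = (∂ a ∧ℰ b) Z
    ∂[a∧z] : ∂ (a ∧ℰ z) ≈ℰ (∂ a ∧ℰ z) +ℰ (sign ∣ A ∣ ·ℰ a)
    ∂[a∧z] = ≈ℰ-trans (∂-leibniz-e A ⁅ i ⁆ dAi) λ Y →
      +-congˡ (*-congˡ (≈-trans (∧ℰ-congˡ a (∂-e-⁅⁆ i) Y) (e-∧ℰ-e-⊥ A Y)))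
    ∂[z∧b] : ∂ (z ∧ℰ b) ≈ℰ b +ℰ (sign 1 ·ℰ (z ∧ℰ ∂ b))
    ∂[z∧b] = ≈ℰ-trans (∂-leibniz-e ⁅ i ⁆ B diB) λ Y →
      +-cong (≈-trans (∧ℰ-congʳ b (∂-e-⁅⁆ i) Y) (∧ℰ-identityˡ b Y))
             (≈-reflexive (cong (λ k → sign k * (z ∧ℰ ∂ b) Y) (∣⁅x⁆∣≡1 i)))
    u′≈u : u′ ≈ u
    u′≈u = ≈-sym (∧ℰ-assoc (∂ a) z (∂ b) Z)
    cancel : w + v ≈ (u + v) + (w + sign 1 * u′)
    cancel = ≈-sym (begin
      (u + v) + (w + sign 1 * u′)  ≈⟨ +-congˡ (+-congˡ (≈-trans (-1*x≈-x u′) (-‿cong u′≈u))) ⟩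
      (u + v) + (w + - u)          ≈⟨ +-congˡ (+-comm w (- u)) ⟩
      (u + v) + (- u + w)          ≈⟨ +-interchange u v (- u) w ⟩
      (u + - u) + (v + w)          ≈⟨ +-congʳ (-‿inverseʳ u) ⟩
      0# + (v + w)                 ≈⟨ +-identityˡ _ ⟩
      v + w                        ≈⟨ +-comm v w ⟩
      w + v                        ∎)

  ∂-e-∪ : (S W : Subset n) → Disjoint S W → ∂ (e (S ∪ W)) ≈ℰ sign (inv S W) ·ℰ ∂ (e S ∧ℰ e W)
  ∂-e-∪ S W d Z = ≈-sym (begin
    sign (inv S W) * ∂ (e S ∧ℰ e W) Z                   ≈⟨ *-congˡ (∂-e-∧ℰ-e S W Z) ⟩
    sign (inv S W) * (wedgeSign S W * ∂ (e (S ∪ W)) Z)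
      ≡⟨ cong (λ w → sign (inv S W) * (w * ∂ (e (S ∪ W)) Z)) (wedgeSign-disjoint d) ⟩
    sign (inv S W) * (sign (inv S W) * ∂ (e (S ∪ W)) Z) ≈⟨ sign-*-sign (inv S W) (inv S W) _ ⟩
    sign (inv S W +ℕ inv S W) * ∂ (e (S ∪ W)) Z         ≈⟨ *-congʳ (sign-double (inv S W)) ⟩
    1# * ∂ (e (S ∪ W)) Z                                ≈⟨ *-identityˡ _ ⟩
    ∂ (e (S ∪ W)) Z                                     ∎)
    where open ≈-Reasoning

  -- Ideals generated by images under ∂

  InIdeal-mono : ∀ {𝔛 𝔜 : Subset n → Set} → (∀ {X} → 𝔛 X → InIdeal 𝔜 (∂ (e X))) →
                 ∀ {a} → InIdeal 𝔛 a → InIdeal 𝔜 a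
  InIdeal-mono f (gen X∈𝔛)    = f X∈𝔛
  InIdeal-mono f zer          = zer
  InIdeal-mono f (add p q)    = add (InIdeal-mono f p) (InIdeal-mono f q)
  InIdeal-mono f (mulˡ b p)   = mulˡ b (InIdeal-mono f p)
  InIdeal-mono f (mulʳ b p)   = mulʳ b (InIdeal-mono f p)
  InIdeal-mono f (resp a≈b p) = resp a≈b (InIdeal-mono f p)

  module _ {𝔛 : Subset n → Set} where

    InIdeal-· : ∀ x {a} → InIdeal 𝔛 a → InIdeal 𝔛 (x ·ℰ a)
    InIdeal-· x {a} a∈I =
      resp (≈ℰ-trans (∧ℰ-·ˡ x (e ⊥) a) (·ℰ-cong ≈-refl (∧ℰ-identityˡ a))) (mulˡ (x ·ℰ e ⊥) a∈I)

    ∂-e-Δ-∈ : ∀ {C₁ C₂ i} → C₁ ∩ C₂ ≡ ⁅ i ⁆ →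
              InIdeal 𝔛 (∂ (e C₁)) → InIdeal 𝔛 (∂ (e C₂)) → InIdeal 𝔛 (∂ (e (C₁ Δ C₂)))
    ∂-e-Δ-∈ {C₁} {C₂} {i} C₁∩C₂≡i C₁∈I C₂∈I =
      resp (≈ℰ-sym ∂eC≈) (InIdeal-· (sign (inv A B)) (add (mulʳ (∂ (e B)) A∧i∈I) (mulˡ (∂ (e A)) i∧B∈I)))
      where
      A = C₁ - i
      B = C₂ - i
      A∧i∈I : InIdeal 𝔛 (∂ (e A ∧ℰ e ⁅ i ⁆))
      A∧i∈I = resp (≈ℰ-sym (∂-e-∧ℰ-e A ⁅ i ⁆))
                (InIdeal-· _ (subst (InIdeal 𝔛 ∘ ∂ ∘ e) (sym (p-x∪⁅x⁆≡p C₁ i (∩≡⁅x⁆⇒x∈pᵇ C₁∩C₂≡i))) C₁∈I))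
      i∧B∈I : InIdeal 𝔛 (∂ (e ⁅ i ⁆ ∧ℰ e B))
      i∧B∈I = resp (≈ℰ-sym (∂-e-∧ℰ-e ⁅ i ⁆ B))
                (InIdeal-· _ (subst (InIdeal 𝔛 ∘ ∂ ∘ e)
                                    (sym (trans (∪-comm ⁅ i ⁆ B) (p-x∪⁅x⁆≡p C₂ i (∩≡⁅x⁆⇒x∈qᵇ C₁∩C₂≡i)))) C₂∈I))
      ∂eC≈ : ∂ (e (C₁ Δ C₂)) ≈ℰ
             sign (inv A B) ·ℰ ((∂ (e A ∧ℰ e ⁅ i ⁆) ∧ℰ ∂ (e B)) +ℰ (∂ (e A) ∧ℰ ∂ (e ⁅ i ⁆ ∧ℰ e B)))
      ∂eC≈ = ≈ℰ-trans (≈ℰ-reflexive (cong (∂ ∘ e) (sym (∩≡⁅x⁆⇒[p-x]∪[q-x]≡pΔq C₁∩C₂≡i))))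
        (≈ℰ-trans (∂-e-∪ A B dAB) (·ℰ-cong ≈-refl (∂-∧ℰ-split A B i dAi diB dAB)))
        where
        dAi = disjoint-p-x-⁅x⁆ C₁ i
        diB = disjoint-comm B ⁅ i ⁆ (disjoint-p-x-⁅x⁆ C₂ i)
        dAB = ∩≡⁅x⁆⇒disjoint C₁∩C₂≡i

  InIdeal-vanishes : ∀ {𝔛 : Subset n → Set} {H : Set} (C : Subset n) →
                     (∀ {X} → 𝔛 X → ∀ Y → Y ⊆ C → ∂ (e X) Y ≈ 0# ⊎ H) →
                     ∀ {a} → InIdeal 𝔛 a → ∀ Y → Y ⊆ C → a Y ≈ 0# ⊎ H
  InIdeal-vanishes C on-gen (gen X∈𝔛) Y Y⊆C = on-gen X∈𝔛 Y Y⊆C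
  InIdeal-vanishes C on-gen zer Y Y⊆C = inj₁ ≈-refl
  InIdeal-vanishes C on-gen (add p q) Y Y⊆C
    with InIdeal-vanishes C on-gen p Y Y⊆C | InIdeal-vanishes C on-gen q Y Y⊆C
  ... | inj₂ η | _      = inj₂ η
  ... | inj₁ _ | inj₂ η = inj₂ η
  ... | inj₁ x | inj₁ y = inj₁ (≈-trans (+-cong x y) (+-identityˡ 0#))
  InIdeal-vanishes {H = H} C on-gen (mulˡ {a} b p) Y Y⊆C = Σ-vanishes-or (allSubsets n) summand
    where
    summand : ∀ X → wedgeTerm Y X (b X * a (Y ─ X)) ≈ 0# ⊎ H
    summand X with InIdeal-vanishes C on-gen p (Y ─ X) (⊆-trans (p─q⊆p Y X) Y⊆C)
    ... | inj₂ η = inj₂ η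
    ... | inj₁ z = inj₁ (≈-trans (wedgeTerm-cong Y X (≈-trans (*-congˡ z) (zeroʳ _)))
                                 (wedgeTerm-zero Y X))
  InIdeal-vanishes {H = H} C on-gen (mulʳ {a} b p) Y Y⊆C = Σ-vanishes-or (allSubsets n) summand
    where
    summand : ∀ X → wedgeTerm Y X (a X * b (Y ─ X)) ≈ 0# ⊎ H
    summand X = by-cases (≡-dec Bool._≟_ (X ∩ Y) X)
      where
      by-cases : Dec (X ∩ Y ≡ X) → wedgeTerm Y X (a X * b (Y ─ X)) ≈ 0# ⊎ H
      by-cases (no X⊈Y) = inj₁ (≈-reflexive (wedgeTerm-⊈ (a X * b (Y ─ X)) X⊈Y))
      by-cases (yes X⊆Y) with InIdeal-vanishes C on-gen p X (⊆-trans (subst (_⊆ Y) X⊆Y (p∩q⊆q X Y)) Y⊆C)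
      ... | inj₂ η = inj₂ η
      ... | inj₁ z = inj₁ (≈-trans (wedgeTerm-cong Y X (≈-trans (*-congʳ z) (zeroˡ _)))
                                   (wedgeTerm-zero Y X))
  InIdeal-vanishes C on-gen (resp a≈b p) Y Y⊆C with InIdeal-vanishes C on-gen p Y Y⊆C
  ... | inj₂ η = inj₂ η
  ... | inj₁ z = inj₁ (≈-trans (≈-sym (a≈b Y)) z)

module BinaryMatroid {n r : ℕ} (M : Matroid n) (A : Fin n → Vec Bool r)
  (represents : ∀ X → (Circuit M X → MinimalDependent A X) × (MinimalDependent A X → Circuit M X)) where

  infixl 6 _⊕_

  _⊕_ : Vec Bool r → Vec Bool r → Vec Bool r
  _⊕_ = zipWith _xor_

  0ᵛ : Vec Bool r
  0ᵛ = replicate r false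

  ⊕-commutativeSemigroup : CommutativeSemigroup _ _
  ⊕-commutativeSemigroup = record
    { Carrier = Vec Bool r
    ; _≈_     = _≡_
    ; _∙_     = _⊕_
    ; isCommutativeSemigroup = record
      { isSemigroup = record
        { isMagma = record { isEquivalence = ≡.isEquivalence ; ∙-cong = cong₂ _⊕_ }
        ; assoc   = zipWith-assoc xor-assoc
        }
      ; comm = zipWith-comm xor-comm
      }
    }

  open import Algebra.Properties.CommutativeSemigroup ⊕-commutativeSemigroup using (x∙yz≈y∙xz; interchange)

  ⊕-self : (v : Vec Bool r) → v ⊕ v ≡ 0ᵛ
  ⊕-self = xor-self
    where
    xor-self : ∀ {k} (v : Vec Bool k) → zipWith _xor_ v v ≡ replicate k false
    xor-self []      = refl
    xor-self (b ∷ v) = cong₂ _∷_ (xor-same b) (xor-self v)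

  ZeroSum : Subset n → Set
  ZeroSum T = columnSum A T ≡ 0ᵛ

  columnSum-Δ : (X Y : Subset n) → columnSum A (X Δ Y) ≡ columnSum A X ⊕ columnSum A Y
  columnSum-Δ X Y = over (allFin n)
    where
    sumOver : List (Fin n) → Subset n → Vec Bool r
    sumOver xs T = foldr (λ i acc → if lookup T i then A i ⊕ acc else acc) 0ᵛ xs
    over : (xs : List (Fin n)) → sumOver xs (X Δ Y) ≡ sumOver xs X ⊕ sumOver xs Y
    over []       = sym (⊕-self 0ᵛ)
    over (i ∷ xs) rewrite lookup-zipWith _xor_ i X Y | over xs with lookup X i | lookup Y i
    ... | true  | true  = sym (trans (interchange (A i) (sumOver xs X) (A i) (sumOver xs Y))
                                     (trans (cong (_⊕ (sumOver xs X ⊕ sumOver xs Y)) (⊕-self (A i)))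
                                            (zipWith-identityˡ xor-identityˡ _)))
    ... | true  | false = sym (zipWith-assoc xor-assoc (A i) _ _)
    ... | false | true  = x∙yz≈y∙xz (A i) (sumOver xs X) (sumOver xs Y)
    ... | false | false = refl

  zeroSum-Δ : ∀ {X Y} → ZeroSum X → ZeroSum Y → ZeroSum (X Δ Y)
  zeroSum-Δ {X} {Y} zX zY = trans (columnSum-Δ X Y) (trans (cong₂ _⊕_ zX zY) (⊕-self 0ᵛ))

  circuit⇒zeroSum : ∀ {C} → Circuit M C → ZeroSum C
  circuit⇒zeroSum {C} C∈𝓒 with proj₁ (represents C) C∈𝓒
  ... | (T , T≠∅ , T⊆C , zT) , minimal =
    subst ZeroSum (⊆∧⊄⇒≡ T⊆C (λ T⊂C → minimal T T⊂C (T , T≠∅ , ⊆-refl , zT))) zT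

  zeroSum⇒circuit⊆ : ∀ T → Nonempty T → ZeroSum T → ∃[ D ] (Circuit M D × D ⊆ T)
  zeroSum⇒circuit⊆ = All.wfRec (On.wellFounded ∣_∣ <-wellFounded) _ _ step
    where
    step : ∀ T → (∀ {T′} → ∣ T′ ∣ < ∣ T ∣ → Nonempty T′ → ZeroSum T′ → ∃[ D ] (Circuit M D × D ⊆ T′)) →
           Nonempty T → ZeroSum T → ∃[ D ] (Circuit M D × D ⊆ T)
    step T rec T≠∅ zT
      with anySubset? (λ T′ → nonempty? T′ ×-dec T′ ⊂? T ×-dec ≡-dec Bool._≟_ (columnSum A T′) 0ᵛ)
    ... | yes (T′ , T′≠∅ , T′⊂T , zT′) with rec (p⊂q⇒∣p∣<∣q∣ T′⊂T) T′≠∅ zT′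
    ...   | D , D∈𝓒 , D⊆T′ = D , D∈𝓒 , ⊆-trans D⊆T′ (p⊂q⇒p⊆q T′⊂T)
    step T rec T≠∅ zT | no ∄T′ = T , proj₂ (represents T) ((T , T≠∅ , ⊆-refl , zT) , minimal) , ⊆-refl
      where
      minimal : ∀ Y → Y ⊂ T → ¬ Dependent A Y
      minimal Y Y⊂T (T′ , T′≠∅ , T′⊆Y , zT′) = ∄T′ (T′ , T′≠∅ , ⊆-⊂-trans T′⊆Y Y⊂T , zT′)

  other-element : Simple M → ∀ {D} → Circuit M D → (j : Fin n) → ∃[ y ] (y ∈ D × y ≢ j)
  other-element simple {D} D∈𝓒 j with nonempty? (D - j)
  ... | yes (y , y∈D-j) =
    y , p─q⊆p D ⁅ j ⁆ y∈D-j , λ { refl → case trans (sym ([]=⇒lookup y∈D-j)) (x∉p-xᵇ D j) of λ () }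
  ... | no  D-j≡∅ =
    contradiction (p⊆q⇒∣p∣≤∣q∣ D⊆⁅j⁆)
                  (<⇒≱ (≤-trans (subst (_< 3) (sym (∣⁅x⁆∣≡1 j)) (s≤s (s≤s z≤n))) (simple D D∈𝓒)))
    where
    D⊆⁅j⁆ : D ⊆ ⁅ j ⁆
    D⊆⁅j⁆ {x} x∈D with x Fin.≟ j
    ... | yes refl = x∈⁅x⁆ x
    ... | no  x≢j  = contradiction (x , x∈p∧x≢y⇒x∈p-y x∈D x≢j) D-j≡∅

  circuit-through : Simple M → ∀ {C D j} → Circuit M C → Circuit M D → ∣ D ∣ < ∣ C ∣ →
                    j ∈ D → D - j ⊆ C → ∃[ D′ ] (Circuit M D′ × j ∈ D′ × D′ ⊆ C Δ D)
  circuit-through simple {C} {D} {j} C∈𝓒 D∈𝓒 ∣D∣<∣C∣ j∈D D-j⊆C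
    with zeroSum⇒circuit⊆ (C Δ D) (j , x∈pΔq⁺ʳ j∉C j∈D)
                          (zeroSum-Δ {C} {D} (circuit⇒zeroSum C∈𝓒) (circuit⇒zeroSum D∈𝓒))
    where
    j∉C : j ∉ C
    j∉C j∈C = <-irrefl (cong ∣_∣ (incomparable M D∈𝓒 C∈𝓒 D⊆C)) ∣D∣<∣C∣
      where
      D⊆C : D ⊆ C
      D⊆C {x} x∈D with x Fin.≟ j
      ... | yes refl = j∈C
      ... | no  x≢j  = D-j⊆C (x∈p∧x≢y⇒x∈p-y x∈D x≢j)
  ... | D′ , D′∈𝓒 , D′⊆CΔD with j ∈? D′
  ...   | yes j∈D′ = D′ , D′∈𝓒 , j∈D′ , D′⊆CΔD
  ...   | no  j∉D′ with other-element simple D∈𝓒 j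
  ...     | y , y∈D , y≢j = contradiction (pΔq∩q⊆⁅y⁆ D-j⊆C (D′⊆CΔD y∈D′) y∈D) y≢j
    where
    D′⊆C : D′ ⊆ C
    D′⊆C {x} x∈D′ with x∈pΔq⁻ (D′⊆CΔD x∈D′)
    ... | inj₁ (x∈C , _) = x∈C
    ... | inj₂ (_ , x∈D) = contradiction (subst (_∈ D′) (pΔq∩q⊆⁅y⁆ D-j⊆C (D′⊆CΔD x∈D′) x∈D) x∈D′) j∉D′
    y∈D′ : y ∈ D′
    y∈D′ = subst (y ∈_) (sym (incomparable M D′∈𝓒 C∈𝓒 D′⊆C)) (D-j⊆C (x∈p∧x≢y⇒x∈p-y y∈D y≢j))

  chord-from-smaller : Simple M → ∀ {C D j} → Circuit M C → Circuit M D → ∣ D ∣ < ∣ C ∣ →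
                       j ∈ D → D - j ⊆ C → HasChord M C
  chord-from-smaller simple {C} {D} {j} C∈𝓒 D∈𝓒 ∣D∣<∣C∣ j∈D D-j⊆C
    with circuit-through simple C∈𝓒 D∈𝓒 ∣D∣<∣C∣ j∈D D-j⊆C | other-element simple D∈𝓒 j
  ... | D′ , D′∈𝓒 , j∈D′ , D′⊆CΔD | y , y∈D , y≢j
    with zeroSum⇒circuit⊆ (D Δ D′) (y , x∈pΔq⁺ˡ y∈D (λ y∈D′ → y≢j (pΔq∩q⊆⁅y⁆ D-j⊆C (D′⊆CΔD y∈D′) y∈D)))
                          (zeroSum-Δ {D} {D′} (circuit⇒zeroSum D∈𝓒) (circuit⇒zeroSum D′∈𝓒))
  ... | D″ , D″∈𝓒 , D″⊆DΔD′ = j , D , D′ , D∈𝓒 , D′∈𝓒 , D∩D′≡⁅j⁆ , C≡DΔD′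
    where
    D∩D′⊆⁅j⁆ : ∀ {x} → x ∈ D′ → x ∈ D → x ≡ j
    D∩D′⊆⁅j⁆ x∈D′ = pΔq∩q⊆⁅y⁆ D-j⊆C (D′⊆CΔD x∈D′)

    D∩D′≡⁅j⁆ : D ∩ D′ ≡ ⁅ j ⁆
    D∩D′≡⁅j⁆ = ⊆-antisym
      (λ x∈D∩D′ → let x∈D , x∈D′ = x∈p∩q⁻ D D′ x∈D∩D′ in
                  subst (_∈ ⁅ j ⁆) (sym (D∩D′⊆⁅j⁆ x∈D′ x∈D)) (x∈⁅x⁆ j))
      (λ x∈⁅j⁆ → subst (_∈ D ∩ D′) (sym (x∈⁅y⁆⇒x≡y j x∈⁅j⁆)) (x∈p∩q⁺ (j∈D , j∈D′)))

    DΔD′⊆C : D Δ D′ ⊆ C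
    DΔD′⊆C {x} x∈DΔD′ with x∈pΔq⁻ x∈DΔD′
    ... | inj₁ (x∈D , x∉D′) = D-j⊆C (x∈p∧x≢y⇒x∈p-y x∈D λ { refl → x∉D′ j∈D′ })
    ... | inj₂ (x∉D , x∈D′) with x∈pΔq⁻ (D′⊆CΔD x∈D′)
    ...   | inj₁ (x∈C , _) = x∈C
    ...   | inj₂ (_ , x∈D) = contradiction x∈D x∉D

    C≡DΔD′ : C ≡ D Δ D′
    C≡DΔD′ =
      ⊆-antisym (subst (_⊆ D Δ D′) (incomparable M D″∈𝓒 C∈𝓒 (⊆-trans D″⊆DΔD′ DΔD′⊆C)) D″⊆DΔD′) DΔD′⊆C

module Chordality {c ℓ} (R : CommutativeRing c ℓ) {n : ℕ} (M : Matroid n) (simple : Simple M) where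

  open CommutativeRing R using (_≈_; _*_; 0#; 1#; *-congʳ; *-congˡ; zeroˡ; zeroʳ)
    renaming (sym to ≈-sym; trans to ≈-trans; reflexive to ≈-reflexive)
  open Exterior R n
  open ExteriorProperties R n

  ∂e∈Im-small : ∀ k → Chordal-ℓ M (2 +ℕ k) → ∀ C → Circuit M C → InIdeal (Circuits≤ M (suc k)) (∂ (e C))
  ∂e∈Im-small k chordal = All.wfRec (On.wellFounded ∣_∣ <-wellFounded) _ _ step
    where
    step : ∀ C → (∀ {C′} → ∣ C′ ∣ < ∣ C ∣ → Circuit M C′ → InIdeal (Circuits≤ M (suc k)) (∂ (e C′))) →
           Circuit M C → InIdeal (Circuits≤ M (suc k)) (∂ (e C))
    step C rec C∈𝓒 with ∣ C ∣ ≤? suc k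
    ... | yes small = gen (C∈𝓒 , small)
    ... | no  large with chordal C C∈𝓒 (≰⇒> large)
    ...   | i , C₁ , C₂ , C₁∈𝓒 , C₂∈𝓒 , C₁∩C₂≡i , refl =
      ∂-e-Δ-∈ C₁∩C₂≡i (rec (∣p∣<∣pΔq∣ C₁∩C₂≡i (simple C₂ C₂∈𝓒)) C₁∈𝓒)
                      (rec (∣q∣<∣pΔq∣ C₁∩C₂≡i (simple C₁ C₁∈𝓒)) C₂∈𝓒)

  chordal⇒adic : ∀ k → Chordal-ℓ M (2 +ℕ k) → SameIdeal (Circuit M) (Circuits≤ M (suc k))
  chordal⇒adic k chordal _ = InIdeal-mono (∂e∈Im-small k chordal _) , InIdeal-mono (gen ∘ proj₁)

  adic⇒chordal : Binary M → ¬ (1# ≈ 0#) →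
                 ∀ k → SameIdeal (Circuit M) (Circuits≤ M (3 +ℕ k)) → Chordal-ℓ M (4 +ℕ k)
  adic⇒chordal (r , A , represents) 1≉0 k same C C∈𝓒 4+k≤∣C∣
    with ∣p∣>0⇒nonempty C (≤-trans (s≤s z≤n) 4+k≤∣C∣)
  ... | c , c∈C
    with InIdeal-vanishes C small-vanishes (proj₁ (same (∂ (e C))) (gen C∈𝓒)) (C - c) (p─q⊆p C ⁅ c ⁆)
    where
    open BinaryMatroid M A represents
    small-vanishes : ∀ {D} → Circuits≤ M (3 +ℕ k) D → ∀ Y → Y ⊆ C → ∂ (e D) Y ≈ 0# ⊎ HasChord M C
    small-vanishes {D} (D∈𝓒 , ∣D∣≤3+k) Y Y⊆C =
      Sum.map₁ (≈-trans (∂-e D Y))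
        (Σ-vanishes-or (allFin n) λ j → term j (lookup D j) refl (≡-dec Bool._≟_ (D - j) Y))
      where
      term : ∀ j b → lookup D j ≡ b → Dec (D - j ≡ Y) → ∂coeff D j * e (D - j) Y ≈ 0# ⊎ HasChord M C
      term j false Dj _ = inj₁ (≈-trans (*-congʳ (≈-reflexive (∂coeff-∉ D j Dj))) (zeroˡ _))
      term j true  Dj (yes refl) =
        inj₂ (chord-from-smaller simple C∈𝓒 D∈𝓒 (≤-trans (s≤s ∣D∣≤3+k) 4+k≤∣C∣) (lookup⇒[]= j D Dj) Y⊆C)
      term j true  Dj (no D-j≢Y) = inj₁ (≈-trans (*-congˡ (≈-reflexive (e-off D-j≢Y))) (zeroʳ _))
  ... | inj₂ chord = chord
  ... | inj₁ vanishes =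
    contradiction (≈-trans (≈-sym (∂-e-at-removal C c ([]=⇒lookup c∈C))) vanishes)
                  (sign-nonzero 1≉0 (inv ⁅ c ⁆ (C - c)))

corollary7 : ∀ {c ℓ} (n : ℕ) (M : Matroid n) → Simple M → Binary M →
               (K : Field c ℓ) →
               ((l : ℕ) → 4 ≤ l → (Chordal-ℓ M l ⇔ Adic K M (l ∸ 2)))
               × (Chordal M ⇔ Quadratic K M)
corollary7 n M simple binary K = ℓ-chordal⇔adic , ℓ-chordal⇔adic 4 (s≤s (s≤s (s≤s (s≤s z≤n))))
  where
  open Chordality (Field.commutativeRing K) M simple
  ℓ-chordal⇔adic : (l : ℕ) → 4 ≤ l → (Chordal-ℓ M l ⇔ Adic K M (l ∸ 2))
  ℓ-chordal⇔adic (suc (suc (suc (suc k)))) (s≤s (s≤s (s≤s (s≤s z≤n)))) =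
    mk⇔ (chordal⇒adic (2 +ℕ k)) (adic⇒chordal binary (Field.nontrivial K) k)
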